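{- Let $\mathcal{P}=C_1\cup\dots\cup C_w$ be a disjoint union of chains with $|C_i|=\ell_i$ (no relations between distinct chains). Then the linear extension diameter of the downset lattice $\mathcal{D}_\mathcal{P}$ equals \[\frac14\left(\Big(\prod_{i=1}^{w}(\ell_i+1)\Big)^2-\sum_{k=1}^{w}(\ell_k+1)\ell_k\prod_{i\neq k}(\ell_i+1)-\prod_{i=1}^{w}(\ell_i+1)\right).\]
   Context: $\mathcal{D}_\mathcal{P}$ is the poset of downsets of $\mathcal{P}$ ordered by inclusion. The linear extension diameter of a finite poset is the maximum, over pairs of its linear extensions, of the number of unordered pairs of elements appearing in different orders in the two. -}

module Defs where

open import Data.Bool using (Bool; true; false; _∧_; if_then_else_)
open import Data.Nat using (ℕ; zero; suc; _+_; _*_; _≤_; _<ᵇ_)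
open import Data.Fin as Fin using (Fin; _≟_)
open import Data.List using (List; []; _∷_; length; lookup; map; concatMap; allFin; filter; filterᵇ; foldr)
open import Data.Nat.ListAction using (sum; product)
open import Data.List.Relation.Unary.Any using (Any)
open import Data.Product using (Σ; ∃; ∃-syntax; _×_; _,_; proj₁)
open import Relation.Binary.PropositionalEquality using (_≡_)
open import Relation.Nullary using (¬_; ¬?)

-- The poset P = C₁ ∪ … ∪ C_w : a disjoint union of w chains,
-- chain i having ℓ i elements.  An element is a pair (i , a) with
-- a : Fin (ℓ i) its position in chain i.

Elem : (w : ℕ) → (Fin w → ℕ) → Set
Elem w ℓ = Σ (Fin w) (λ i → Fin (ℓ i))

data _≤P_ {w : ℕ} {ℓ : Fin w → ℕ} : Elem w ℓ → Elem w ℓ → Set where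
  same-chain : ∀ {i : Fin w} {a b : Fin (ℓ i)} → a Fin.≤ b → (i , a) ≤P (i , b)

elems : (w : ℕ) (ℓ : Fin w → ℕ) → List (Elem w ℓ)
elems w ℓ = concatMap (λ i → map (λ a → (i , a)) (allFin (ℓ i))) (allFin w)

Subset : (w : ℕ) → (Fin w → ℕ) → Set
Subset w ℓ = Elem w ℓ → Bool

IsDownset : ∀ {w ℓ} → Subset w ℓ → Set
IsDownset {w} {ℓ} D = ∀ {x y : Elem w ℓ} → x ≤P y → D y ≡ true → D x ≡ true

Downset : (w : ℕ) → (Fin w → ℕ) → Set
Downset w ℓ = Σ (Subset w ℓ) IsDownset

_≐_ : ∀ {w ℓ} → Downset w ℓ → Downset w ℓ → Set
D ≐ E = ∀ x → proj₁ D x ≡ proj₁ E x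

_⊆_ : ∀ {w ℓ} → Downset w ℓ → Downset w ℓ → Set
D ⊆ E = ∀ x → proj₁ D x ≡ true → proj₁ E x ≡ true

record IsLinearExtension {w : ℕ} {ℓ : Fin w → ℕ} (L : List (Downset w ℓ)) : Set where
  field
    covers   : ∀ (D : Downset w ℓ) → Any (D ≐_) L
    distinct : ∀ (i j : Fin (length L)) → i Fin.< j → ¬ (lookup L i ≐ lookup L j)
    monotone : ∀ (i j : Fin (length L)) → lookup L i ⊆ lookup L j → i Fin.≤ j

_≐ᵇ_ : ∀ {w ℓ} → Downset w ℓ → Downset w ℓ → Bool
_≐ᵇ_ {w} {ℓ} D E = foldr (λ x b → eqB (proj₁ D x) (proj₁ E x) ∧ b) true (elems w ℓ)
  where
  eqB : Bool → Bool → Bool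
  eqB true  y = y
  eqB false true  = false
  eqB false false = true

position : ∀ {w ℓ} → List (Downset w ℓ) → Downset w ℓ → ℕ
position []      D = 0
position (E ∷ L) D = if E ≐ᵇ D then 0 else suc (position L D)

disagree : ∀ {w ℓ} → List (Downset w ℓ) → List (Downset w ℓ) → ℕ
disagree []      L₂ = 0
disagree (D ∷ L) L₂ =
  length (filterᵇ (λ E → position L₂ E <ᵇ position L₂ D) L) + disagree L L₂

IsLinExtDiameter : (w : ℕ) (ℓ : Fin w → ℕ) → ℕ → Set
IsLinExtDiameter w ℓ d =
  (∃[ L₁ ] ∃[ L₂ ] (IsLinearExtension {w} {ℓ} L₁ × IsLinearExtension {w} {ℓ} L₂ × disagree L₁ L₂ ≡ d))
  × (∀ (L₁ L₂ : List (Downset w ℓ)) → IsLinearExtension L₁ → IsLinearExtension L₂ → disagree L₁ L₂ ≤ d)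

prodAll : (w : ℕ) → (Fin w → ℕ) → ℕ
prodAll w ℓ = product (map (λ i → suc (ℓ i)) (allFin w))

prodExcept : (w : ℕ) → (Fin w → ℕ) → Fin w → ℕ
prodExcept w ℓ k = product (map (λ i → suc (ℓ i)) (filter (λ i → ¬? (i ≟ k)) (allFin w)))

sumTerm : (w : ℕ) → (Fin w → ℕ) → ℕ
sumTerm w ℓ = sum (map (λ k → suc (ℓ k) * ℓ k * prodExcept w ℓ k) (allFin w))

-- A downset of a disjoint union of chains is determined by how many elements it takes from
-- each chain, so D_P is the product of the chains {0, …, ℓᵢ}, and a linear extension of D_P is
-- an injective monotone ranking of its N = ∏ᵢ (ℓᵢ + 1) points.  Two rankings disagree on an
-- unordered pair of points exactly when the ordered pair is discordant for them.  Group the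
-- ordered pairs (p, q) by the coordinates in which they differ and the two values taken there:
-- a group with k differing coordinates is a cube {0,1}ᵏ (one bit per coordinate saying which of
-- p, q is lower there), on which "r ranks p below q" is monotone and, for k ≥ 1, self-dual.  By
-- the Harris–Kleitman inequality two monotone self-dual functions agree on at least half of the
-- cube, and everywhere when k = 1.  Hence four times the number of pairs on which two linear
-- extensions disagree is at most the number of ordered pairs of points differing in at least two
-- coordinates, N² − N − N ∑ᵢ ℓᵢ.  The lexicographic and colexicographic extensions attain this:
-- they are discordant on exactly half of every cube with k ≥ 2.

module Submission where

open import Defs
open import Data.Bool as Bool using (Bool; true; false; not; _∧_; _∨_; _xor_; if_then_else_; f≤t; b≤b)
open import Data.Bool.Properties using (T-≡; ∧-identityʳ; ∧-zeroʳ; ∨-identityʳ)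
open import Data.Empty using (⊥; ⊥-elim)
open import Data.Fin as Fin using (Fin; zero; suc; toℕ; fromℕ<)
open import Data.Fin.Properties using (toℕ-injective; toℕ<n; toℕ-fromℕ<)
open import Data.List using (List; []; _∷_; _++_; map; concatMap; length; allFin; tabulate; foldr; lookup; filter; filterᵇ)
open import Data.List.Membership.Propositional using (_∈_; lose)
open import Data.List.Membership.Propositional.Properties using (∈-map⁺; ∈-concatMap⁺; ∈-allFin; ∈-lookup)
open import Data.List.Properties using (map-tabulate; length-map; length-tabulate; filter-all; tabulate-lookup)
open import Data.List.Relation.Unary.All as All using (All; []; _∷_)
open import Data.List.Relation.Unary.All.Properties using (map⁺)
open import Data.List.Relation.Unary.AllPairs using (AllPairs; []; _∷_)
open import Data.List.Relation.Unary.AllPairs.Properties using (tabulate⁺-<)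
open import Data.List.Relation.Unary.Any as Any using (Any; here; there)
import Data.List.Relation.Unary.Any.Properties as Any
open import Data.List.Relation.Unary.Unique.Propositional using (Unique)
open import Data.List.Relation.Unary.Unique.Propositional.Properties using (allFin⁺)
open import Data.Nat
open import Data.Nat.ListAction using (sum; product)
open import Data.Nat.Properties
open import Data.Nat.Tactic.RingSolver using (solve-∀)
open import Data.Product using (Σ; ∃-syntax; _×_; _,_; proj₁; proj₂)
open import Data.Unit using (⊤)
open import Data.Vec as Vec using (Vec; []; _∷_)
open import Data.Vec.Relation.Binary.Pointwise.Inductive using (Pointwise; []; _∷_)
open import Function using (_∘_; Equivalence)
open import Relation.Binary.Definitions using (tri<; tri≈; tri>)
open import Relation.Binary.PropositionalEquality
open import Relation.Nullary using (¬_; yes; no; ¬?)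

private variable
  A B : Set
  m n w : ℕ
  ℓ : Fin w → ℕ

∑ : List A → (A → ℕ) → ℕ
∑ []       f = 0
∑ (x ∷ xs) f = f x + ∑ xs f

syntax ∑ xs (λ x → e) = ∑[ x ∈ xs ] e

𝟙 : Bool → ℕ
𝟙 true  = 1
𝟙 false = 0

∑-cong : (xs : List A) {f g : A → ℕ} → (∀ x → f x ≡ g x) → ∑ xs f ≡ ∑ xs g
∑-cong []       f≗g = refl
∑-cong (x ∷ xs) f≗g = cong₂ _+_ (f≗g x) (∑-cong xs f≗g)

∑-mono : (xs : List A) {f g : A → ℕ} → (∀ x → f x ≤ g x) → ∑ xs f ≤ ∑ xs g
∑-mono []       f≤g = z≤n
∑-mono (x ∷ xs) f≤g = +-mono-≤ (f≤g x) (∑-mono xs f≤g)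

∑-zero : (xs : List A) → ∑[ x ∈ xs ] 0 ≡ 0
∑-zero []       = refl
∑-zero (x ∷ xs) = ∑-zero xs

∑-one : (xs : List A) → ∑[ x ∈ xs ] 1 ≡ length xs
∑-one []       = refl
∑-one (x ∷ xs) = cong suc (∑-one xs)

∑-+ : (xs : List A) (f g : A → ℕ) → ∑[ x ∈ xs ] (f x + g x) ≡ ∑ xs f + ∑ xs g
∑-+ []       f g = refl
∑-+ (x ∷ xs) f g = begin
  f x + g x + ∑[ y ∈ xs ] (f y + g y) ≡⟨ cong (f x + g x +_) (∑-+ xs f g) ⟩
  f x + g x + (∑ xs f + ∑ xs g)       ≡⟨ +-+-swap (f x) (g x) _ _ ⟩
  f x + ∑ xs f + (g x + ∑ xs g)       ∎
  where
  open ≡-Reasoning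
  +-+-swap : ∀ a b c d → a + b + (c + d) ≡ a + c + (b + d)
  +-+-swap = solve-∀

∑-*ˡ : (xs : List A) (c : ℕ) (f : A → ℕ) → ∑[ x ∈ xs ] (c * f x) ≡ c * ∑ xs f
∑-*ˡ []       c f = sym (*-zeroʳ c)
∑-*ˡ (x ∷ xs) c f = trans (cong (c * f x +_) (∑-*ˡ xs c f)) (sym (*-distribˡ-+ c (f x) _))

∑-*ʳ : (xs : List A) (c : ℕ) (f : A → ℕ) → ∑[ x ∈ xs ] (f x * c) ≡ ∑ xs f * c
∑-*ʳ []       c f = refl
∑-*ʳ (x ∷ xs) c f = trans (cong (f x * c +_) (∑-*ʳ xs c f)) (sym (*-distribʳ-+ c (f x) _))

∑-const : (xs : List A) (c : ℕ) → ∑[ x ∈ xs ] c ≡ length xs * c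
∑-const xs c = trans (∑-cong xs (λ _ → sym (*-identityˡ c))) (trans (∑-*ʳ xs c (λ _ → 1)) (cong (_* c) (∑-one xs)))

∑-++ : (xs ys : List A) (f : A → ℕ) → ∑ (xs ++ ys) f ≡ ∑ xs f + ∑ ys f
∑-++ []       ys f = refl
∑-++ (x ∷ xs) ys f = trans (cong (f x +_) (∑-++ xs ys f)) (sym (+-assoc (f x) _ _))

∑-map : (xs : List A) (g : A → B) (f : B → ℕ) → ∑ (map g xs) f ≡ ∑[ x ∈ xs ] f (g x)
∑-map []       g f = refl
∑-map (x ∷ xs) g f = cong (f (g x) +_) (∑-map xs g f)

∑-concatMap : (xs : List A) (g : A → List B) (f : B → ℕ) → ∑ (concatMap g xs) f ≡ ∑[ x ∈ xs ] ∑ (g x) f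
∑-concatMap []       g f = refl
∑-concatMap (x ∷ xs) g f = trans (∑-++ (g x) _ f) (cong (∑ (g x) f +_) (∑-concatMap xs g f))

∑-swap : (xs : List A) (ys : List B) (f : A → B → ℕ) →
  ∑[ x ∈ xs ] ∑[ y ∈ ys ] f x y ≡ ∑[ y ∈ ys ] ∑[ x ∈ xs ] f x y
∑-swap []       ys f = sym (∑-zero ys)
∑-swap (x ∷ xs) ys f = trans (cong (∑ ys (f x) +_) (∑-swap xs ys f)) (sym (∑-+ ys (f x) _))

∑-cong-All : {xs : List A} {f g : A → ℕ} → All (λ x → f x ≡ g x) xs → ∑ xs f ≡ ∑ xs g
∑-cong-All []           = refl
∑-cong-All (fx≡gx ∷ eq) = cong₂ _+_ fx≡gx (∑-cong-All eq)

length-filterᵇ : (P : A → Bool) (xs : List A) → length (filterᵇ P xs) ≡ ∑[ x ∈ xs ] 𝟙 (P x)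
length-filterᵇ P []       = refl
length-filterᵇ P (x ∷ xs) with P x
... | true  = cong suc (length-filterᵇ P xs)
... | false = length-filterᵇ P xs

𝟙-∧ : (a b : Bool) → 𝟙 (a ∧ b) ≡ 𝟙 a * 𝟙 b
𝟙-∧ true  b = sym (+-identityʳ (𝟙 b))
𝟙-∧ false b = refl

𝟙-not : (a : Bool) → 𝟙 a + 𝟙 (not a) ≡ 1
𝟙-not true  = refl
𝟙-not false = refl

𝟙-xor : (a b : Bool) → 𝟙 (a xor b) + 2 * 𝟙 (a ∧ b) ≡ 𝟙 a + 𝟙 b
𝟙-xor true  true  = refl
𝟙-xor true  false = refl
𝟙-xor false true  = refl
𝟙-xor false false = refl

bool-ext : {a b : Bool} → (a ≡ true → b ≡ true) → (b ≡ true → a ≡ true) → a ≡ b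
bool-ext {true}  {true}  a⇒b b⇒a = refl
bool-ext {true}  {false} a⇒b b⇒a = sym (a⇒b refl)
bool-ext {false} {true}  a⇒b b⇒a = b⇒a refl
bool-ext {false} {false} a⇒b b⇒a = refl

≢true⇒≡false : {a : Bool} → ¬ a ≡ true → a ≡ false
≢true⇒≡false {true}  a≢true = ⊥-elim (a≢true refl)
≢true⇒≡false {false} a≢true = refl

<⇒<ᵇ≡true : m < n → (m <ᵇ n) ≡ true
<⇒<ᵇ≡true m<n = Equivalence.to T-≡ (<⇒<ᵇ m<n)

<ᵇ≡true⇒< : ∀ m n → (m <ᵇ n) ≡ true → m < n
<ᵇ≡true⇒< m n e = <ᵇ⇒< m n (Equivalence.from T-≡ e)

≮⇒<ᵇ≡false : ¬ m < n → (m <ᵇ n) ≡ false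
≮⇒<ᵇ≡false m≮n = ≢true⇒≡false (m≮n ∘ <ᵇ≡true⇒< _ _)

n<ᵇn≡false : (n : ℕ) → (n <ᵇ n) ≡ false
n<ᵇn≡false n = ≮⇒<ᵇ≡false (n≮n n)

<ᵇ-flip : m ≢ n → (n <ᵇ m) ≡ not (m <ᵇ n)
<ᵇ-flip {m} {n} m≢n with <-cmp m n
... | tri< m<n _ _ rewrite <⇒<ᵇ≡true m<n = ≮⇒<ᵇ≡false (<⇒≯ m<n)
... | tri≈ _ m≡n _ = ⊥-elim (m≢n m≡n)
... | tri> _ _ n<m rewrite ≮⇒<ᵇ≡false (<⇒≯ n<m) = <⇒<ᵇ≡true n<m

≡ᵇ-refl : (n : ℕ) → (n ≡ᵇ n) ≡ true
≡ᵇ-refl zero    = refl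
≡ᵇ-refl (suc n) = ≡ᵇ-refl n

≡ᵇ≡true⇒≡ : (m n : ℕ) → (m ≡ᵇ n) ≡ true → m ≡ n
≡ᵇ≡true⇒≡ m n e = ≡ᵇ⇒≡ m n (Equivalence.from T-≡ e)

≢⇒≡ᵇ≡false : m ≢ n → (m ≡ᵇ n) ≡ false
≢⇒≡ᵇ≡false {m} {n} m≢n = ≢true⇒≡false (m≢n ∘ ≡ᵇ≡true⇒≡ m n)

_=ᶠ_ : Fin n → Fin n → Bool
a =ᶠ b = toℕ a ≡ᵇ toℕ b

=ᶠ-refl : (a : Fin n) → (a =ᶠ a) ≡ true
=ᶠ-refl a = ≡ᵇ-refl (toℕ a)

=ᶠ-sound : (a b : Fin n) → (a =ᶠ b) ≡ true → a ≡ b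
=ᶠ-sound a b e = toℕ-injective (≡ᵇ≡true⇒≡ (toℕ a) (toℕ b) e)

=ᶠ-sym : (a b : Fin n) → (a =ᶠ b) ≡ (b =ᶠ a)
=ᶠ-sym a b = bool-ext (λ e → subst (λ x → (x =ᶠ a) ≡ true) (=ᶠ-sound a b e) (=ᶠ-refl a))
                      (λ e → subst (λ x → (x =ᶠ b) ≡ true) (=ᶠ-sound b a e) (=ᶠ-refl b))

<⇒=ᶠ≡false : (a b : Fin n) → toℕ a < toℕ b → (a =ᶠ b) ≡ false
<⇒=ᶠ≡false a b a<b = ≢⇒≡ᵇ≡false (<⇒≢ a<b)

∑-allFin-suc : (f : Fin (suc n) → ℕ) → ∑ (allFin (suc n)) f ≡ f zero + ∑[ i ∈ allFin n ] f (suc i)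
∑-allFin-suc {n} f = cong (f zero +_) (trans (cong (λ xs → ∑ xs f) (sym (map-tabulate (λ i → i) suc))) (∑-map (allFin n) suc f))

∑-δᶠ : (a : Fin n) (f : Fin n → ℕ) → ∑[ b ∈ allFin n ] (𝟙 (a =ᶠ b) * f b) ≡ f a
∑-δᶠ {suc n} zero f = begin
  ∑[ b ∈ allFin (suc n) ] (𝟙 (zero =ᶠ b) * f b)  ≡⟨ ∑-allFin-suc (λ b → 𝟙 (zero =ᶠ b) * f b) ⟩
  f zero + 0 + ∑[ b ∈ allFin n ] 0               ≡⟨ cong (f zero + 0 +_) (∑-zero (allFin n)) ⟩
  f zero + 0 + 0                                 ≡⟨ trans (+-identityʳ _) (+-identityʳ _) ⟩
  f zero                                         ∎
  where open ≡-Reasoning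
∑-δᶠ {suc n} (suc a) f = trans (∑-allFin-suc (λ b → 𝟙 (suc a =ᶠ b) * f b)) (∑-δᶠ a (f ∘ suc))

-- A point of ∏ᵢ {0, …, ℓᵢ}; it stands for the downset made of the lowest coord p i elements of
-- each chain i (see toDownset).
infixr 5 _∷_

data Point : (w : ℕ) → (Fin w → ℕ) → Set where
  []  : Point zero ℓ
  _∷_ : Fin (suc (ℓ zero)) → Point w (ℓ ∘ suc) → Point (suc w) ℓ

points : (w : ℕ) (ℓ : Fin w → ℕ) → List (Point w ℓ)
points zero    ℓ = [] ∷ []
points (suc w) ℓ = concatMap (λ a → map (a ∷_) (points w (ℓ ∘ suc))) (allFin (suc (ℓ zero)))

coord : Point w ℓ → (i : Fin w) → Fin (suc (ℓ i))
coord (a ∷ p) zero    = a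
coord (a ∷ p) (suc i) = coord p i

_≼_ : Point w ℓ → Point w ℓ → Set
_≼_ []      []      = ⊤
_≼_ (a ∷ p) (b ∷ q) = toℕ a ≤ toℕ b × p ≼ q

_=ᵖ_ : Point w ℓ → Point w ℓ → Bool
_=ᵖ_ []      []      = true
_=ᵖ_ (a ∷ p) (b ∷ q) = (a =ᶠ b) ∧ (p =ᵖ q)

=ᵖ-refl : (p : Point w ℓ) → (p =ᵖ p) ≡ true
=ᵖ-refl []      = refl
=ᵖ-refl (a ∷ p) rewrite =ᶠ-refl a = =ᵖ-refl p

=ᵖ-sound : (p q : Point w ℓ) → (p =ᵖ q) ≡ true → p ≡ q
=ᵖ-sound []      []      e = refl
=ᵖ-sound (a ∷ p) (b ∷ q) e with a =ᶠ b in a=b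
... | true = cong₂ _∷_ (=ᶠ-sound a b a=b) (=ᵖ-sound p q e)

=ᵖ-sym : (p q : Point w ℓ) → (p =ᵖ q) ≡ (q =ᵖ p)
=ᵖ-sym []      []      = refl
=ᵖ-sym (a ∷ p) (b ∷ q) = cong₂ _∧_ (=ᶠ-sym a b) (=ᵖ-sym p q)

≢⇒=ᵖ≡false : (p q : Point w ℓ) → p ≢ q → (p =ᵖ q) ≡ false
≢⇒=ᵖ≡false p q p≢q = ≢true⇒≡false (p≢q ∘ =ᵖ-sound p q)

∈-points : (p : Point w ℓ) → p ∈ points w ℓ
∈-points []      = here refl
∈-points {suc w} {ℓ} (a ∷ p) = ∈-concatMap⁺ (λ b → map (b ∷_) (points w (ℓ ∘ suc))) (lose (∈-allFin a) (∈-map⁺ (a ∷_) (∈-points p)))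

∑-points-suc : (w : ℕ) (ℓ : Fin (suc w) → ℕ) (f : Point (suc w) ℓ → ℕ) →
  ∑ (points (suc w) ℓ) f ≡ ∑[ a ∈ allFin (suc (ℓ zero)) ] ∑[ p ∈ points w (ℓ ∘ suc) ] f (a ∷ p)
∑-points-suc w ℓ f = trans (∑-concatMap (allFin (suc (ℓ zero))) (λ a → map (a ∷_) (points w (ℓ ∘ suc))) f)
                               (∑-cong (allFin (suc (ℓ zero))) (λ a → ∑-map (points w (ℓ ∘ suc)) (a ∷_) f))

∑-δ : (p : Point w ℓ) (f : Point w ℓ → ℕ) → ∑[ q ∈ points w ℓ ] (𝟙 (p =ᵖ q) * f q) ≡ f p
∑-δ []      f = trans (+-identityʳ _) (+-identityʳ _)
∑-δ {suc w} {ℓ} (a ∷ p) f = begin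
  ∑[ q ∈ points (suc w) ℓ ] (𝟙 ((a ∷ p) =ᵖ q) * f q)
    ≡⟨ ∑-points-suc w ℓ (λ q → 𝟙 ((a ∷ p) =ᵖ q) * f q) ⟩
  ∑[ b ∈ allFin (suc (ℓ zero)) ] ∑[ q ∈ points w (ℓ ∘ suc) ] (𝟙 ((a =ᶠ b) ∧ (p =ᵖ q)) * f (b ∷ q))
    ≡⟨ ∑-cong (allFin (suc (ℓ zero))) (λ b → ∑-cong (points w (ℓ ∘ suc)) (λ q →
         trans (cong (_* f (b ∷ q)) (𝟙-∧ (a =ᶠ b) (p =ᵖ q))) (*-assoc (𝟙 (a =ᶠ b)) _ _))) ⟩
  ∑[ b ∈ allFin (suc (ℓ zero)) ] ∑[ q ∈ points w (ℓ ∘ suc) ] (𝟙 (a =ᶠ b) * (𝟙 (p =ᵖ q) * f (b ∷ q)))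
    ≡⟨ ∑-cong (allFin (suc (ℓ zero))) (λ b → trans (∑-*ˡ (points w (ℓ ∘ suc)) (𝟙 (a =ᶠ b)) _)
                                       (cong (𝟙 (a =ᶠ b) *_) (∑-δ p (λ q → f (b ∷ q))))) ⟩
  ∑[ b ∈ allFin (suc (ℓ zero)) ] (𝟙 (a =ᶠ b) * f (b ∷ p))
    ≡⟨ ∑-δᶠ a (λ b → f (b ∷ p)) ⟩
  f (a ∷ p) ∎
  where open ≡-Reasoning

∑-δ′ : (p : Point w ℓ) (f : Point w ℓ → ℕ) → ∑[ q ∈ points w ℓ ] (𝟙 (q =ᵖ p) * f q) ≡ f p
∑-δ′ {w} {ℓ} p f = trans (∑-cong (points w ℓ) (λ q → cong (λ b → 𝟙 b * f q) (=ᵖ-sym q p))) (∑-δ p f)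

length-points-suc : (w : ℕ) (ℓ : Fin (suc w) → ℕ) →
  length (points (suc w) ℓ) ≡ suc (ℓ zero) * length (points w (ℓ ∘ suc))
length-points-suc w ℓ = begin
  length (points (suc w) ℓ)                ≡⟨ sym (∑-one (points (suc w) ℓ)) ⟩
  ∑[ p ∈ points (suc w) ℓ ] 1              ≡⟨ ∑-points-suc w ℓ (λ _ → 1) ⟩
  ∑[ a ∈ allFin (suc (ℓ zero)) ] ∑[ p ∈ P′ ] 1   ≡⟨ ∑-cong (allFin (suc (ℓ zero))) (λ _ → ∑-one P′) ⟩
  ∑[ a ∈ allFin (suc (ℓ zero)) ] length P′       ≡⟨ ∑-const (allFin (suc (ℓ zero))) (length P′) ⟩
  length (allFin (suc (ℓ zero))) * length P′     ≡⟨ cong (_* length P′) (length-tabulate {n = suc (ℓ zero)} (λ i → i)) ⟩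
  suc (ℓ zero) * length P′                       ∎
  where
  open ≡-Reasoning
  P′ = points w (ℓ ∘ suc)

=ᵖ≡false⇒≢ : (p q : Point w ℓ) → (p =ᵖ q) ≡ false → p ≢ q
=ᵖ≡false⇒≢ p q p≠q refl with () ← trans (sym p≠q) (=ᵖ-refl p)

-- Downsets of a disjoint union of chains are points

tabulateᵖ : ((i : Fin w) → Fin (suc (ℓ i))) → Point w ℓ
tabulateᵖ {zero}  f = []
tabulateᵖ {suc w} f = f zero ∷ tabulateᵖ (f ∘ suc)

coord-tabulateᵖ : (f : (i : Fin w) → Fin (suc (ℓ i))) (i : Fin w) → coord (tabulateᵖ f) i ≡ f i
coord-tabulateᵖ f zero    = refl
coord-tabulateᵖ f (suc i) = coord-tabulateᵖ (f ∘ suc) i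

coord-injective : (p q : Point w ℓ) → (∀ i → coord p i ≡ coord q i) → p ≡ q
coord-injective []      []      eq = refl
coord-injective (a ∷ p) (b ∷ q) eq = cong₂ _∷_ (eq zero) (coord-injective p q (eq ∘ suc))

≼⇒coord≤ : (p q : Point w ℓ) → p ≼ q → ∀ i → toℕ (coord p i) ≤ toℕ (coord q i)
≼⇒coord≤ (a ∷ p) (b ∷ q) (a≤b , p≼q) zero    = a≤b
≼⇒coord≤ (a ∷ p) (b ∷ q) (a≤b , p≼q) (suc i) = ≼⇒coord≤ p q p≼q i

coord≤⇒≼ : (p q : Point w ℓ) → (∀ i → toℕ (coord p i) ≤ toℕ (coord q i)) → p ≼ q
coord≤⇒≼ []      []      le = _
coord≤⇒≼ (a ∷ p) (b ∷ q) le = le zero , coord≤⇒≼ p q (le ∘ suc)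

toDownset : Point w ℓ → Downset w ℓ
toDownset p = (λ (i , x) → toℕ x <ᵇ toℕ (coord p i)) , down
  where
  down : IsDownset (λ (i , x) → toℕ x <ᵇ toℕ (coord p i))
  down (same-chain {i} {a} {b} a≤b) b∈ = <⇒<ᵇ≡true (≤-<-trans a≤b (<ᵇ≡true⇒< (toℕ b) (toℕ (coord p i)) b∈))

height : (n : ℕ) → (Fin n → Bool) → Fin (suc n)
height zero    f = zero
height (suc n) f = if f zero then suc (height n (f ∘ suc)) else zero

height-cong : (n : ℕ) {f g : Fin n → Bool} → (∀ x → f x ≡ g x) → height n f ≡ height n g
height-cong zero    f≗g = refl
height-cong (suc n) f≗g rewrite f≗g zero | height-cong n (f≗g ∘ suc) = refl

height-initial : (n : ℕ) (f : Fin n → Bool) → (∀ x y → toℕ x ≤ toℕ y → f y ≡ true → f x ≡ true) →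
  ∀ x → f x ≡ (toℕ x <ᵇ toℕ (height n f))
height-initial (suc n) f initial x with f zero in f0
height-initial (suc n) f initial x | false with f x in fx
... | true  = sym (trans (sym f0) (initial zero x z≤n fx))
... | false = refl
height-initial (suc n) f initial zero    | true = f0
height-initial (suc n) f initial (suc x) | true =
  height-initial n (f ∘ suc) (λ a b a≤b → initial (suc a) (suc b) (s≤s a≤b)) x

height-below : (n : ℕ) (c : Fin (suc n)) → height n (λ x → toℕ x <ᵇ toℕ c) ≡ c
height-below zero    zero    = refl
height-below (suc n) zero    = refl
height-below (suc n) (suc c) = cong suc (height-below n c)

toPoint : Downset w ℓ → Point w ℓ
toPoint {ℓ = ℓ} (D , _) = tabulateᵖ (λ i → height (ℓ i) (λ x → D (i , x)))

toPoint-toDownset : (p : Point w ℓ) → toPoint (toDownset p) ≡ p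
toPoint-toDownset {ℓ = ℓ} p = coord-injective _ p (λ i →
  trans (coord-tabulateᵖ _ i) (height-below (ℓ i) (coord p i)))

toDownset-toPoint : (D : Downset w ℓ) → toDownset (toPoint D) ≐ D
toDownset-toPoint {ℓ = ℓ} (D , isDown) (i , x) =
  trans (cong (λ c → toℕ x <ᵇ toℕ c) (coord-tabulateᵖ _ i))
        (sym (height-initial (ℓ i) (λ y → D (i , y)) (λ a b a≤b → isDown (same-chain a≤b)) x))

toPoint-cong : {D E : Downset w ℓ} → D ≐ E → toPoint D ≡ toPoint E
toPoint-cong {ℓ = ℓ} D≐E = coord-injective _ _ (λ i →
  trans (coord-tabulateᵖ _ i) (trans (height-cong (ℓ i) (λ x → D≐E (i , x))) (sym (coord-tabulateᵖ _ i))))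

toDownset-injective : (p q : Point w ℓ) → toDownset p ≐ toDownset q → p ≡ q
toDownset-injective p q eq =
  trans (sym (toPoint-toDownset p)) (trans (toPoint-cong {D = toDownset p} {toDownset q} eq) (toPoint-toDownset q))

toPoint-injective : (D E : Downset w ℓ) → toPoint D ≡ toPoint E → D ≐ E
toPoint-injective D E eq x = begin
  proj₁ D x                         ≡⟨ toDownset-toPoint D x ⟨
  proj₁ (toDownset (toPoint D)) x   ≡⟨ cong (λ p → proj₁ (toDownset p) x) eq ⟩
  proj₁ (toDownset (toPoint E)) x   ≡⟨ toDownset-toPoint E x ⟩
  proj₁ E x                         ∎
  where open ≡-Reasoning

toDownset-mono : (p q : Point w ℓ) → p ≼ q → toDownset p ⊆ toDownset q
toDownset-mono p q p≼q (i , x) x∈ = <⇒<ᵇ≡true (<-≤-trans (<ᵇ≡true⇒< (toℕ x) (toℕ (coord p i)) x∈) (≼⇒coord≤ p q p≼q i))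

-- If coord q i < coord p i, the element at height coord q i of chain i separates the two downsets.
toDownset-reflects : (p q : Point w ℓ) → toDownset p ⊆ toDownset q → p ≼ q
toDownset-reflects {ℓ = ℓ} p q p⊆q = coord≤⇒≼ p q (λ i → ≮⇒≥ (λ q<p → separated i q<p))
  where
  separated : ∀ i → toℕ (coord q i) < toℕ (coord p i) → ⊥
  separated i q<p = <-irrefl (toℕ-fromℕ< q<ℓ) (<ᵇ≡true⇒< (toℕ x) (toℕ (coord q i)) (p⊆q (i , x) x∈p))
    where
    q<ℓ : toℕ (coord q i) < ℓ i
    q<ℓ = <-≤-trans q<p (≤-pred (toℕ<n (coord p i)))
    x : Fin (ℓ i)
    x = fromℕ< q<ℓ
    x∈p : (toℕ x <ᵇ toℕ (coord p i)) ≡ true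
    x∈p = <⇒<ᵇ≡true (subst (_< toℕ (coord p i)) (sym (toℕ-fromℕ< q<ℓ)) q<p)

-- Linear extensions as rankings of points

foldr-∧-true : {X : Set} (k : X → Bool) {xs : List X} {x : X} →
  foldr (λ y b → k y ∧ b) true xs ≡ true → x ∈ xs → k x ≡ true
foldr-∧-true k {y ∷ xs} all (here refl) with k y
... | true = refl
foldr-∧-true k {y ∷ xs} all (there x∈xs) with k y
... | true = foldr-∧-true k all x∈xs

foldr-∧-false : {X : Set} (k : X → Bool) (xs : List X) →
  foldr (λ y b → k y ∧ b) true xs ≡ false → ∃[ x ] k x ≡ false
foldr-∧-false k (y ∷ xs) none with k y in ky
... | false = y , ky
... | true  = foldr-∧-false k xs none

∈-elems : (x : Elem w ℓ) → x ∈ elems w ℓ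
∈-elems {w} {ℓ} (i , a) =
  ∈-concatMap⁺ (λ j → map (j ,_) (allFin (ℓ j))) (lose (∈-allFin i) (∈-map⁺ (i ,_) (∈-allFin a)))

≐ᵇ-sound : (D E : Downset w ℓ) → (D ≐ᵇ E) ≡ true → D ≐ E
≐ᵇ-sound {w} {ℓ} D E eq x with proj₁ D x | proj₁ E x | foldr-∧-true _ eq (∈-elems x)
... | true  | true  | _ = refl
... | false | false | _ = refl

≐ᵇ-complete : (D E : Downset w ℓ) → D ≐ E → (D ≐ᵇ E) ≡ true
≐ᵇ-complete {w} {ℓ} D E D≐E with D ≐ᵇ E in eq
... | true  = refl
... | false with foldr-∧-false _ (elems w ℓ) eq
...   | x , differs with proj₁ D x | proj₁ E x | D≐E x | differs
...     | true  | .true  | refl | ()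
...     | false | .false | refl | ()

≭⇒≐ᵇ≡false : (D E : Downset w ℓ) → ¬ D ≐ E → (D ≐ᵇ E) ≡ false
≭⇒≐ᵇ≡false D E D≭E = ≢true⇒≡false (D≭E ∘ ≐ᵇ-sound D E)

≐ᵇ-congʳ : (G : Downset w ℓ) {D E : Downset w ℓ} → D ≐ E → (G ≐ᵇ D) ≡ (G ≐ᵇ E)
≐ᵇ-congʳ G {D} {E} D≐E =
  bool-ext (λ G=D → ≐ᵇ-complete G E (λ x → trans (≐ᵇ-sound G D G=D x) (D≐E x)))
           (λ G=E → ≐ᵇ-complete G D (λ x → trans (≐ᵇ-sound G E G=E x) (sym (D≐E x))))

position-here : (D : Downset w ℓ) (L : List (Downset w ℓ)) → position (D ∷ L) D ≡ 0
position-here D L rewrite ≐ᵇ-complete D D (λ _ → refl) = refl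

position-there : (E D : Downset w ℓ) (L : List (Downset w ℓ)) → ¬ E ≐ D →
  position (E ∷ L) D ≡ suc (position L D)
position-there E D L E≭D rewrite ≭⇒≐ᵇ≡false E D E≭D = refl

position-cong : (L : List (Downset w ℓ)) {D E : Downset w ℓ} → D ≐ E → position L D ≡ position L E
position-cong []      D≐E = refl
position-cong (G ∷ L) {D} {E} D≐E
  rewrite ≐ᵇ-congʳ G {D} {E} D≐E | position-cong L {D} {E} D≐E = refl

locate : (L : List (Downset w ℓ)) (D : Downset w ℓ) → Any (D ≐_) L →
  Σ (Fin (length L)) (λ i → toℕ i ≡ position L D × lookup L i ≐ D)
locate (E ∷ L) D D∈L with E ≐ᵇ D in E=D
... | true = zero , refl , ≐ᵇ-sound E D E=D
locate (E ∷ L) D (here D≐E) | false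
  with () ← trans (sym E=D) (≐ᵇ-complete E D (λ x → sym (D≐E x)))
locate (E ∷ L) D (there D∈L) | false with locate L D D∈L
... | i , i≡pos , Lᵢ≐D = suc i , cong suc i≡pos , Lᵢ≐D

Distinct : List (Downset w ℓ) → Set
Distinct = AllPairs (λ D E → ¬ D ≐ E)

distinct-lookup : (L : List (Downset w ℓ)) →
  (∀ i j → i Fin.< j → ¬ lookup L i ≐ lookup L j) → Distinct L
distinct-lookup L distinct = subst Distinct (tabulate-lookup L) (tabulate⁺-< (λ {i} {j} → distinct i j))

inverted : (r₁ r₂ : A → ℕ) → A → A → Bool
inverted r₁ r₂ x y = (r₁ x <ᵇ r₁ y) ∧ (r₂ y <ᵇ r₂ x)

inversions : (r₁ r₂ : Point w ℓ → ℕ) → ℕ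
inversions {w} {ℓ} r₁ r₂ = ∑[ p ∈ points w ℓ ] ∑[ q ∈ points w ℓ ] 𝟙 (inverted r₁ r₂ p q)

inversions-cong : {r₁ r₁′ r₂ r₂′ : Point w ℓ → ℕ} → (∀ p → r₁ p ≡ r₁′ p) → (∀ p → r₂ p ≡ r₂′ p) →
  inversions r₁ r₂ ≡ inversions r₁′ r₂′
inversions-cong {w} {ℓ} {r₁} {r₁′} {r₂} {r₂′} r₁≗r₁′ r₂≗r₂′ =
  ∑-cong (points w ℓ) (λ p → ∑-cong (points w ℓ) (λ q → pointwise p q))
  where
  pointwise : ∀ p q → 𝟙 (inverted r₁ r₂ p q) ≡ 𝟙 (inverted r₁′ r₂′ p q)
  pointwise p q rewrite r₁≗r₁′ p | r₁≗r₁′ q | r₂≗r₂′ p | r₂≗r₂′ q = refl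

disagree-∑ : (L₁ L₂ : List (Downset w ℓ)) → Distinct L₁ →
  disagree L₁ L₂ ≡ ∑[ E ∈ L₁ ] ∑[ F ∈ L₁ ] 𝟙 (inverted (position L₁) (position L₂) E F)
disagree-∑ []      L₂ []                 = refl
disagree-∑ (D ∷ L) L₂ (D≭L ∷ distinct) = begin
  length (filterᵇ (λ E → Q E <ᵇ Q D) L) + disagree L L₂
    ≡⟨ cong₂ _+_ (length-filterᵇ (λ E → Q E <ᵇ Q D) L) (disagree-∑ L L₂ distinct) ⟩
  ∑[ F ∈ L ] 𝟙 (Q F <ᵇ Q D) + ∑[ E ∈ L ] ∑[ F ∈ L ] 𝟙 (inverted P Q E F)
    ≡⟨ cong₂ _+_ (sym rowD) (sym (∑-cong-All (All.map rowE shift))) ⟩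
  ∑[ F ∈ D ∷ L ] 𝟙 (inverted P₁ Q D F) + ∑[ E ∈ L ] ∑[ F ∈ D ∷ L ] 𝟙 (inverted P₁ Q E F) ∎
  where
  open ≡-Reasoning
  P₁ P Q : Downset _ _ → ℕ
  P₁ = position (D ∷ L)
  P  = position L
  Q  = position L₂
  shift : All (λ F → P₁ F ≡ suc (P F)) L
  shift = All.map (position-there D _ L) D≭L
  rowD : ∑[ F ∈ D ∷ L ] 𝟙 (inverted P₁ Q D F) ≡ ∑[ F ∈ L ] 𝟙 (Q F <ᵇ Q D)
  rowD rewrite position-here D L =
    ∑-cong-All (All.map (λ {F} eq → cong (λ k → 𝟙 ((0 <ᵇ k) ∧ (Q F <ᵇ Q D))) eq) shift)
  rowE : ∀ {E} → P₁ E ≡ suc (P E) →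
    ∑[ F ∈ D ∷ L ] 𝟙 (inverted P₁ Q E F) ≡ ∑[ F ∈ L ] 𝟙 (inverted P Q E F)
  rowE {E} eq rewrite position-here D L | eq =
    ∑-cong-All (All.map (λ {F} eqF → cong (λ k → 𝟙 ((suc (P E) <ᵇ k) ∧ (Q F <ᵇ Q E))) eqF) shift)

count-absent : (E : Downset w ℓ) {L : List (Downset w ℓ)} → All (λ F → ¬ E ≐ F) L →
  ∑[ F ∈ L ] 𝟙 (toPoint E =ᵖ toPoint F) ≡ 0
count-absent E []                     = refl
count-absent E {F ∷ L} (E≭F ∷ E≭L)
  rewrite ≢⇒=ᵖ≡false (toPoint E) (toPoint F) (E≭F ∘ toPoint-injective E F) = count-absent E E≭L

count-unique : (p : Point w ℓ) {L : List (Downset w ℓ)} → Distinct L → Any (toDownset p ≐_) L →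
  ∑[ E ∈ L ] 𝟙 (p =ᵖ toPoint E) ≡ 1
count-unique p {E ∷ L} (E≭L ∷ _) (here p≐E)
  rewrite trans (sym (toPoint-toDownset p)) (toPoint-cong {D = toDownset p} {E} p≐E)
        | =ᵖ-refl (toPoint E) = cong suc (count-absent E E≭L)
count-unique p {E ∷ L} (E≭L ∷ distinct) (there p∈L) =
  trans (cong (λ b → 𝟙 b + _) (≢⇒=ᵖ≡false p (toPoint E) p≢E)) (count-unique p distinct p∈L)
  where
  p≢E : p ≢ toPoint E
  p≢E refl = All.lookupWith (λ E≭F p≐F → E≭F (λ x → trans (sym (toDownset-toPoint E x)) (p≐F x))) E≭L p∈L

∑-linearExtension : (L : List (Downset w ℓ)) → Distinct L → (∀ D → Any (D ≐_) L) →
  (h : Downset w ℓ → ℕ) → (∀ D E → D ≐ E → h D ≡ h E) →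
  ∑ L h ≡ ∑[ p ∈ points w ℓ ] h (toDownset p)
∑-linearExtension {w} {ℓ} L distinct covers h h-resp = begin
  ∑ L h
    ≡⟨ ∑-cong L (λ E → h-resp E _ (λ x → sym (toDownset-toPoint E x))) ⟩
  ∑[ E ∈ L ] h (toDownset (toPoint E))
    ≡⟨ ∑-cong L (λ E → sym (∑-δ′ (toPoint E) (h ∘ toDownset))) ⟩
  ∑[ E ∈ L ] ∑[ p ∈ points w ℓ ] (𝟙 (p =ᵖ toPoint E) * h (toDownset p))
    ≡⟨ ∑-swap L (points w ℓ) _ ⟩
  ∑[ p ∈ points w ℓ ] ∑[ E ∈ L ] (𝟙 (p =ᵖ toPoint E) * h (toDownset p))
    ≡⟨ ∑-cong (points w ℓ) (λ p → ∑-*ʳ L (h (toDownset p)) (λ E → 𝟙 (p =ᵖ toPoint E))) ⟩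
  ∑[ p ∈ points w ℓ ] (∑[ E ∈ L ] 𝟙 (p =ᵖ toPoint E) * h (toDownset p))
    ≡⟨ ∑-cong (points w ℓ) (λ p → trans (cong (_* h (toDownset p)) (count-unique p distinct (covers (toDownset p))))
                                        (+-identityʳ _)) ⟩
  ∑[ p ∈ points w ℓ ] h (toDownset p) ∎
  where open ≡-Reasoning

rank : List (Downset w ℓ) → Point w ℓ → ℕ
rank L p = position L (toDownset p)

record IsRanking {w : ℕ} {ℓ : Fin w → ℕ} (r : Point w ℓ → ℕ) : Set where
  field
    injective : ∀ p q → r p ≡ r q → p ≡ q
    monotone  : ∀ p q → p ≼ q → r p ≤ r q

rank-isRanking : {L : List (Downset w ℓ)} → IsLinearExtension L → IsRanking (rank L)
rank-isRanking {L = L} isLE = record { injective = injective ; monotone = monotone′ }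
  where
  open IsLinearExtension isLE
  slot : ∀ p → Σ (Fin (length L)) (λ i → toℕ i ≡ rank L p × lookup L i ≐ toDownset p)
  slot p = locate L (toDownset p) (covers (toDownset p))
  injective : ∀ p q → rank L p ≡ rank L q → p ≡ q
  injective p q eq with slot p | slot q
  ... | i , i≡p , Lᵢ≐p | j , j≡q , Lⱼ≐q with toℕ-injective (trans i≡p (trans eq (sym j≡q)))
  ... | refl = toDownset-injective p q (λ x → trans (sym (Lᵢ≐p x)) (Lⱼ≐q x))
  monotone′ : ∀ p q → p ≼ q → rank L p ≤ rank L q
  monotone′ p q p≼q with slot p | slot q
  ... | i , i≡p , Lᵢ≐p | j , j≡q , Lⱼ≐q = subst₂ _≤_ i≡p j≡q (monotone i j Lᵢ⊆Lⱼ)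
    where
    Lᵢ⊆Lⱼ : lookup L i ⊆ lookup L j
    Lᵢ⊆Lⱼ x x∈ = trans (Lⱼ≐q x) (toDownset-mono p q p≼q x (trans (sym (Lᵢ≐p x)) x∈))

disagree≡inversions : {L₁ L₂ : List (Downset w ℓ)} → IsLinearExtension L₁ → IsLinearExtension L₂ →
  disagree L₁ L₂ ≡ inversions (rank L₁) (rank L₂)
disagree≡inversions {w} {ℓ} {L₁} {L₂} isLE₁ isLE₂ = begin
  disagree L₁ L₂
    ≡⟨ disagree-∑ L₁ L₂ distinct₁ ⟩
  ∑[ E ∈ L₁ ] ∑[ F ∈ L₁ ] inv E F
    ≡⟨ ∑-cong L₁ (λ E → ∑-linearExtension L₁ distinct₁ covers (inv E) (λ F F′ F≐F′ → inv-congʳ E F≐F′)) ⟩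
  ∑[ E ∈ L₁ ] ∑[ q ∈ points w ℓ ] inv E (toDownset q)
    ≡⟨ ∑-linearExtension L₁ distinct₁ covers (λ E → ∑[ q ∈ points w ℓ ] inv E (toDownset q))
         (λ E E′ E≐E′ → ∑-cong (points w ℓ) (λ q → inv-congˡ (toDownset q) E≐E′)) ⟩
  ∑[ p ∈ points w ℓ ] ∑[ q ∈ points w ℓ ] inv (toDownset p) (toDownset q) ∎
  where
  open ≡-Reasoning
  open IsLinearExtension isLE₁ using (covers; distinct)
  distinct₁ = distinct-lookup L₁ distinct
  inv : Downset w ℓ → Downset w ℓ → ℕ
  inv E F = 𝟙 (inverted (position L₁) (position L₂) E F)
  inv-congʳ : ∀ E {F F′} → F ≐ F′ → inv E F ≡ inv E F′
  inv-congʳ E {F} {F′} F≐F′ rewrite position-cong L₁ {F} {F′} F≐F′ | position-cong L₂ {F} {F′} F≐F′ = refl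
  inv-congˡ : ∀ F {E E′} → E ≐ E′ → inv E F ≡ inv E′ F
  inv-congˡ F {E} {E′} E≐E′ rewrite position-cong L₁ {E} {E′} E≐E′ | position-cong L₂ {E} {E′} E≐E′ = refl

-- Monotone functions on the cube and the Harris–Kleitman inequality

cube : (n : ℕ) → List (Vec Bool n)
cube zero    = [] ∷ []
cube (suc n) = map (true ∷_) (cube n) ++ map (false ∷_) (cube n)

∑-cube-suc : (n : ℕ) (f : Vec Bool (suc n) → ℕ) →
  ∑ (cube (suc n)) f ≡ ∑[ σ ∈ cube n ] f (true ∷ σ) + ∑[ σ ∈ cube n ] f (false ∷ σ)
∑-cube-suc n f = trans (∑-++ (map (true ∷_) (cube n)) _ f) (cong₂ _+_ (∑-map (cube n) _ f) (∑-map (cube n) _ f))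

length-cube : (n : ℕ) → length (cube n) ≡ 2 ^ n
length-cube zero    = refl
length-cube (suc n) = begin
  length (cube (suc n))           ≡⟨ sym (∑-one (cube (suc n))) ⟩
  ∑[ σ ∈ cube (suc n) ] 1         ≡⟨ ∑-cube-suc n (λ _ → 1) ⟩
  ∑[ σ ∈ cube n ] 1 + ∑[ σ ∈ cube n ] 1   ≡⟨ cong₂ _+_ (∑-one (cube n)) (trans (∑-one (cube n)) (sym (+-identityʳ _))) ⟩
  length (cube n) + (length (cube n) + 0) ≡⟨ cong (λ k → k + (k + 0)) (length-cube n) ⟩
  2 ^ suc n ∎
  where open ≡-Reasoning

∑-cube-not : (f : Vec Bool n → ℕ) → ∑[ σ ∈ cube n ] f (Vec.map not σ) ≡ ∑ (cube n) f
∑-cube-not {zero}  f = refl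
∑-cube-not {suc n} f = begin
  ∑[ σ ∈ cube (suc n) ] f (Vec.map not σ)
    ≡⟨ ∑-cube-suc n (f ∘ Vec.map not) ⟩
  ∑[ σ ∈ cube n ] f (false ∷ Vec.map not σ) + ∑[ σ ∈ cube n ] f (true ∷ Vec.map not σ)
    ≡⟨ cong₂ _+_ (∑-cube-not (f ∘ (false ∷_))) (∑-cube-not (f ∘ (true ∷_))) ⟩
  ∑[ σ ∈ cube n ] f (false ∷ σ) + ∑[ σ ∈ cube n ] f (true ∷ σ)
    ≡⟨ +-comm (∑[ σ ∈ cube n ] f (false ∷ σ)) _ ⟩
  ∑[ σ ∈ cube n ] f (true ∷ σ) + ∑[ σ ∈ cube n ] f (false ∷ σ)
    ≡⟨ ∑-cube-suc n f ⟨
  ∑ (cube (suc n)) f ∎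
  where open ≡-Reasoning

# : (Vec Bool n → Bool) → ℕ
# {n} F = ∑[ σ ∈ cube n ] 𝟙 (F σ)

Monotone : (Vec Bool n → Bool) → Set
Monotone F = ∀ {σ τ} → Pointwise Bool._≤_ σ τ → F σ Bool.≤ F τ

SelfDual : (Vec Bool n → Bool) → Set
SelfDual F = ∀ σ → F (Vec.map not σ) ≡ not (F σ)

𝟙-mono : {a b : Bool} → a Bool.≤ b → 𝟙 a ≤ 𝟙 b
𝟙-mono f≤t = z≤n
𝟙-mono b≤b = ≤-refl

≤ᶜ-refl : (σ : Vec Bool n) → Pointwise Bool._≤_ σ σ
≤ᶜ-refl []      = []
≤ᶜ-refl (b ∷ σ) = b≤b ∷ ≤ᶜ-refl σ

chebyshev₂ : ∀ f₀ f₁ g₀ g₁ → f₀ ≤ f₁ → g₀ ≤ g₁ → (f₁ + f₀) * (g₁ + g₀) ≤ 2 * (f₁ * g₁ + f₀ * g₀)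
chebyshev₂ f₀ f₁ g₀ g₁ f₀≤f₁ g₀≤g₁ with m≤n⇒∃[o]m+o≡n f₀≤f₁ | m≤n⇒∃[o]m+o≡n g₀≤g₁
... | u , refl | v , refl = subst ((f₀ + u + f₀) * (g₀ + v + g₀) ≤_) (sym (expand f₀ u g₀ v)) (m≤m+n _ (u * v))
  where
  expand : ∀ f u g v → 2 * ((f + u) * (g + v) + f * g) ≡ (f + u + f) * (g + v + g) + u * v
  expand = solve-∀

harris-kleitman : (F G : Vec Bool n → Bool) → Monotone F → Monotone G →
  # F * # G ≤ 2 ^ n * # (λ σ → F σ ∧ G σ)
harris-kleitman {zero} F G _ _ rewrite 𝟙-∧ (F []) (G []) =
  subst (_≤ 1 * (𝟙 (F []) * 𝟙 (G []) + 0)) (shape (𝟙 (F [])) (𝟙 (G []))) ≤-refl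
  where
  shape : ∀ a b → 1 * (a * b + 0) ≡ (a + 0) * (b + 0)
  shape = solve-∀
harris-kleitman {suc n} F G mono-F mono-G = begin
  # F * # G
    ≡⟨ cong₂ _*_ (∑-cube-suc n (𝟙 ∘ F)) (∑-cube-suc n (𝟙 ∘ G)) ⟩
  (# F₁ + # F₀) * (# G₁ + # G₀)
    ≤⟨ chebyshev₂ (# F₀) (# F₁) (# G₀) (# G₁) (slice-≤ F mono-F) (slice-≤ G mono-G) ⟩
  2 * (# F₁ * # G₁ + # F₀ * # G₀)
    ≤⟨ *-monoʳ-≤ 2 (+-mono-≤ (harris-kleitman F₁ G₁ (mono-F ∘ (b≤b ∷_)) (mono-G ∘ (b≤b ∷_)))
                             (harris-kleitman F₀ G₀ (mono-F ∘ (b≤b ∷_)) (mono-G ∘ (b≤b ∷_)))) ⟩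
  2 * (2 ^ n * # (λ σ → F₁ σ ∧ G₁ σ) + 2 ^ n * # (λ σ → F₀ σ ∧ G₀ σ))
    ≡⟨ regroup (2 ^ n) _ _ ⟩
  (2 ^ n + (2 ^ n + 0)) * (# (λ σ → F₁ σ ∧ G₁ σ) + # (λ σ → F₀ σ ∧ G₀ σ))
    ≡⟨ cong ((2 ^ n + (2 ^ n + 0)) *_) (∑-cube-suc n (λ σ → 𝟙 (F σ ∧ G σ))) ⟨
  2 ^ suc n * # (λ σ → F σ ∧ G σ) ∎
  where
  open ≤-Reasoning
  F₁ F₀ G₁ G₀ : Vec Bool n → Bool
  F₁ = F ∘ (true ∷_)
  F₀ = F ∘ (false ∷_)
  G₁ = G ∘ (true ∷_)
  G₀ = G ∘ (false ∷_)
  slice-≤ : (H : Vec Bool (suc n) → Bool) → Monotone H → # (H ∘ (false ∷_)) ≤ # (H ∘ (true ∷_))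
  slice-≤ H mono-H = ∑-mono (cube n) (λ σ → 𝟙-mono (mono-H (f≤t ∷ ≤ᶜ-refl σ)))
  regroup : ∀ s a b → 2 * (s * a + s * b) ≡ (s + (s + 0)) * (a + b)
  regroup = solve-∀

#-selfDual : (F : Vec Bool n → Bool) → SelfDual F → 2 * # F ≡ 2 ^ n
#-selfDual {n} F selfDual = begin
  # F + (# F + 0)                                    ≡⟨ cong (# F +_) (+-identityʳ (# F)) ⟩
  # F + # F                                          ≡⟨ cong (# F +_) (∑-cube-not (𝟙 ∘ F)) ⟨
  # F + ∑[ σ ∈ cube n ] 𝟙 (F (Vec.map not σ))        ≡⟨ cong (# F +_) (∑-cong (cube n) (cong 𝟙 ∘ selfDual)) ⟩
  # F + ∑[ σ ∈ cube n ] 𝟙 (not (F σ))                ≡⟨ ∑-+ (cube n) (𝟙 ∘ F) (𝟙 ∘ not ∘ F) ⟨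
  ∑[ σ ∈ cube n ] (𝟙 (F σ) + 𝟙 (not (F σ)))          ≡⟨ ∑-cong (cube n) (𝟙-not ∘ F) ⟩
  ∑[ σ ∈ cube n ] 1                                  ≡⟨ ∑-one (cube n) ⟩
  length (cube n)                                    ≡⟨ length-cube n ⟩
  2 ^ n                                              ∎
  where open ≡-Reasoning

#-xor : (F G : Vec Bool n → Bool) → # (λ σ → F σ xor G σ) + 2 * # (λ σ → F σ ∧ G σ) ≡ # F + # G
#-xor {n} F G = begin
  # (λ σ → F σ xor G σ) + 2 * # (λ σ → F σ ∧ G σ)
    ≡⟨ cong (# (λ σ → F σ xor G σ) +_) (∑-*ˡ (cube n) 2 (λ σ → 𝟙 (F σ ∧ G σ))) ⟨
  # (λ σ → F σ xor G σ) + ∑[ σ ∈ cube n ] (2 * 𝟙 (F σ ∧ G σ))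
    ≡⟨ ∑-+ (cube n) _ _ ⟨
  ∑[ σ ∈ cube n ] (𝟙 (F σ xor G σ) + 2 * 𝟙 (F σ ∧ G σ))
    ≡⟨ ∑-cong (cube n) (λ σ → 𝟙-xor (F σ) (G σ)) ⟩
  ∑[ σ ∈ cube n ] (𝟙 (F σ) + 𝟙 (G σ))
    ≡⟨ ∑-+ (cube n) (𝟙 ∘ F) (𝟙 ∘ G) ⟩
  # F + # G ∎
  where open ≡-Reasoning

#∧-selfDual : (F G : Vec Bool n → Bool) → Monotone F → SelfDual F → Monotone G → SelfDual G →
  2 ^ n ≤ 4 * # (λ σ → F σ ∧ G σ)
#∧-selfDual {n} F G mono-F selfDual-F mono-G selfDual-G =
  quarter (2 ^ n) (# F) (# G) (# (λ σ → F σ ∧ G σ)) (#-selfDual F selfDual-F) (#-selfDual G selfDual-G) (harris-kleitman F G mono-F mono-G)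
  where
  quarter : ∀ c a b x → 2 * a ≡ c → 2 * b ≡ c → a * b ≤ c * x → c ≤ 4 * x
  quarter zero      a b x _ _ _ = z≤n
  quarter c@(suc _) a b x 2a≡c 2b≡c ab≤cx = *-cancelˡ-≤ c (begin
    c * c             ≡⟨ cong₂ _*_ 2a≡c 2b≡c ⟨
    (2 * a) * (2 * b) ≡⟨ regroup₁ a b ⟩
    4 * (a * b)       ≤⟨ *-monoʳ-≤ 4 ab≤cx ⟩
    4 * (c * x)       ≡⟨ regroup₂ c x ⟩
    c * (4 * x)       ∎)
    where
    open ≤-Reasoning
    regroup₁ : ∀ a b → (2 * a) * (2 * b) ≡ 4 * (a * b)
    regroup₁ = solve-∀
    regroup₂ : ∀ c x → 4 * (c * x) ≡ c * (4 * x)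
    regroup₂ = solve-∀

-- The factor 𝟙 (1 <ᵇ n) records that for n = 1 the two functions coincide.
#xor-bound : (F G : Vec Bool n → Bool) → Monotone F → SelfDual F → Monotone G → SelfDual G →
  2 * # (λ σ → F σ xor G σ) ≤ 2 ^ n * 𝟙 (1 <ᵇ n)
#xor-bound {zero} F G _ selfDual-F _ _ = ⊥-elim (not-fixed (F []) (selfDual-F []))
  where
  not-fixed : ∀ b → b ≢ not b
  not-fixed true  ()
  not-fixed false ()
#xor-bound {suc n} F G mono-F selfDual-F mono-G selfDual-G =
  from-counts n (# (λ σ → F σ xor G σ)) (# (λ σ → F σ ∧ G σ)) (#∧-selfDual F G mono-F selfDual-F mono-G selfDual-G) counts
  where
  counts : 2 * # (λ σ → F σ xor G σ) + 4 * # (λ σ → F σ ∧ G σ) ≡ 2 ^ suc n + 2 ^ suc n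
  counts = begin
    2 * E + 4 * X          ≡⟨ regroup E X ⟩
    2 * (E + 2 * X)        ≡⟨ cong (2 *_) (#-xor F G) ⟩
    2 * (# F + # G)        ≡⟨ *-distribˡ-+ 2 (# F) (# G) ⟩
    2 * # F + 2 * # G      ≡⟨ cong₂ _+_ (#-selfDual F selfDual-F) (#-selfDual G selfDual-G) ⟩
    2 ^ suc n + 2 ^ suc n  ∎
    where
    open ≡-Reasoning
    E = # (λ σ → F σ xor G σ)
    X = # (λ σ → F σ ∧ G σ)
    regroup : ∀ e x → 2 * e + 4 * x ≡ 2 * (e + 2 * x)
    regroup = solve-∀
  from-counts : ∀ n e x → 2 ^ suc n ≤ 4 * x → 2 * e + 4 * x ≡ 2 ^ suc n + 2 ^ suc n →
    2 * e ≤ 2 ^ suc n * 𝟙 (1 <ᵇ suc n)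
  from-counts zero    zero    x       _    _  = z≤n
  from-counts zero    (suc e) zero    ()   _
  from-counts zero    (suc e) (suc x) _    eq with trans (sym eq) (expand e x)
    where
    expand : ∀ e x → 2 * suc e + 4 * suc x ≡ 6 + (2 * e + 4 * x)
    expand = solve-∀
  ... | ()
  from-counts (suc n) e       x       c≤4x eq = begin
    2 * e  ≤⟨ +-cancelʳ-≤ c (2 * e) c (begin
                2 * e + c      ≤⟨ +-monoʳ-≤ (2 * e) c≤4x ⟩
                2 * e + 4 * x  ≡⟨ eq ⟩
                c + c          ∎) ⟩
    c      ≡⟨ *-identityʳ c ⟨
    c * 1  ∎
    where
    open ≤-Reasoning
    c = 2 ^ suc (suc n)

≤-from-≡true : {a b : Bool} → (a ≡ true → b ≡ true) → a Bool.≤ b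
≤-from-≡true {false} {false} _   = b≤b
≤-from-≡true {false} {true}  _   = f≤t
≤-from-≡true {true}  {b}     a⇒b with refl ← a⇒b refl = b≤b

-- Pairs of points as vertices of cubes

-- A pair of points is described by its shape (which coordinates agree, and the two
-- values of each disagreeing one) together with a vertex of a cube saying, for each
-- disagreeing coordinate, which of the two points takes the smaller value.
data Gap (m : ℕ) : Set where
  same  : Fin m → Gap m
  apart : (a b : Fin m) → toℕ a < toℕ b → Gap m

data Shape : (w : ℕ) → (Fin w → ℕ) → Set where
  []  : Shape zero ℓ
  _∷_ : Gap (suc (ℓ zero)) → Shape w (ℓ ∘ suc) → Shape (suc w) ℓ

dim : Shape w ℓ → ℕ
dim []                 = 0
dim (same a ∷ sh)      = dim sh
dim (apart a b _ ∷ sh) = suc (dim sh)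

pair : (sh : Shape w ℓ) → Vec Bool (dim sh) → Point w ℓ × Point w ℓ
pair []                 []          = [] , []
pair (same a ∷ sh)      σ           = (a ∷ proj₁ (pair sh σ)) , (a ∷ proj₂ (pair sh σ))
pair (apart a b _ ∷ sh) (true ∷ σ)  = (a ∷ proj₁ (pair sh σ)) , (b ∷ proj₂ (pair sh σ))
pair (apart a b _ ∷ sh) (false ∷ σ) = (b ∷ proj₁ (pair sh σ)) , (a ∷ proj₂ (pair sh σ))

strict : (a b : Fin m) → List (Gap m)
strict a b with toℕ a <? toℕ b
... | yes a<b = apart a b a<b ∷ []
... | no  _   = []

gaps : (m : ℕ) → List (Gap m)
gaps m = map same (allFin m) ++ concatMap (λ a → concatMap (strict a) (allFin m)) (allFin m)

shapes : (w : ℕ) (ℓ : Fin w → ℕ) → List (Shape w ℓ)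
shapes zero    ℓ = [] ∷ []
shapes (suc w) ℓ = concatMap (λ g → map (g ∷_) (shapes w (ℓ ∘ suc))) (gaps (suc (ℓ zero)))

∑-cube : (sh : Shape w ℓ) → (Point w ℓ → Point w ℓ → ℕ) → ℕ
∑-cube sh h = ∑[ σ ∈ cube (dim sh) ] h (proj₁ (pair sh σ)) (proj₂ (pair sh σ))

∑-strict : (a b : Fin m) (G : Gap m → ℕ) (x : ℕ) → (∀ a<b → G (apart a b a<b) ≡ x) →
  ∑ (strict a b) G ≡ 𝟙 (toℕ a <ᵇ toℕ b) * x
∑-strict a b G x G≡x with toℕ a <? toℕ b
... | yes a<b rewrite <⇒<ᵇ≡true a<b = trans (+-identityʳ _) (trans (G≡x a<b) (sym (+-identityʳ x)))
... | no  a≮b rewrite ≮⇒<ᵇ≡false a≮b = refl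

trichotomy : (m n : ℕ) → 𝟙 (m ≡ᵇ n) + (𝟙 (m <ᵇ n) + 𝟙 (n <ᵇ m)) ≡ 1
trichotomy zero    zero    = refl
trichotomy zero    (suc n) = refl
trichotomy (suc m) zero    = refl
trichotomy (suc m) (suc n) = trichotomy m n

∑∑-split-diagonal : (m : ℕ) (g : Fin m → Fin m → ℕ) →
  ∑[ a ∈ allFin m ] ∑[ b ∈ allFin m ] g a b ≡
  ∑[ a ∈ allFin m ] g a a + ∑[ a ∈ allFin m ] ∑[ b ∈ allFin m ] (𝟙 (toℕ a <ᵇ toℕ b) * (g a b + g b a))
∑∑-split-diagonal m g = begin
  ∑∑ (λ a b → g a b)
    ≡⟨ ∑∑-cong (λ a b → sym (trans (cong (_* g a b) (trichotomy (toℕ a) (toℕ b))) (+-identityʳ (g a b)))) ⟩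
  ∑∑ (λ a b → (eq a b + (lt a b + lt b a)) * g a b)
    ≡⟨ ∑∑-cong (λ a b → distrib (eq a b) (lt a b) (lt b a) (g a b)) ⟩
  ∑∑ (λ a b → eq a b * g a b + (lt a b * g a b + lt b a * g a b))
    ≡⟨ trans (∑∑-+ _ _) (cong (∑∑ (λ a b → eq a b * g a b) +_) (∑∑-+ _ _)) ⟩
  ∑∑ (λ a b → eq a b * g a b) + (∑∑ (λ a b → lt a b * g a b) + ∑∑ (λ a b → lt b a * g a b))
    ≡⟨ cong₂ _+_ (∑-cong (allFin m) (λ a → ∑-δᶠ a (g a)))
                 (cong (∑∑ (λ a b → lt a b * g a b) +_) (∑-swap (allFin m) (allFin m) (λ a b → lt b a * g a b))) ⟩
  ∑[ a ∈ allFin m ] g a a + (∑∑ (λ a b → lt a b * g a b) + ∑∑ (λ b a → lt b a * g a b))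
    ≡⟨ cong (∑[ a ∈ allFin m ] g a a +_) (∑∑-+ (λ a b → lt a b * g a b) (λ a b → lt a b * g b a)) ⟨
  ∑[ a ∈ allFin m ] g a a + ∑∑ (λ a b → lt a b * g a b + lt a b * g b a)
    ≡⟨ cong (∑[ a ∈ allFin m ] g a a +_) (∑∑-cong (λ a b → *-distribˡ-+ (lt a b) (g a b) (g b a))) ⟨
  ∑[ a ∈ allFin m ] g a a + ∑∑ (λ a b → lt a b * (g a b + g b a)) ∎
  where
  open ≡-Reasoning
  ∑∑ : (Fin m → Fin m → ℕ) → ℕ
  ∑∑ f = ∑[ a ∈ allFin m ] ∑[ b ∈ allFin m ] f a b
  ∑∑-cong : {f f′ : Fin m → Fin m → ℕ} → (∀ a b → f a b ≡ f′ a b) → ∑∑ f ≡ ∑∑ f′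
  ∑∑-cong f≗f′ = ∑-cong (allFin m) (λ a → ∑-cong (allFin m) (f≗f′ a))
  ∑∑-+ : (f f′ : Fin m → Fin m → ℕ) → ∑∑ (λ a b → f a b + f′ a b) ≡ ∑∑ f + ∑∑ f′
  ∑∑-+ f f′ = trans (∑-cong (allFin m) (λ a → ∑-+ (allFin m) (f a) (f′ a))) (∑-+ (allFin m) _ _)
  eq lt : Fin m → Fin m → ℕ
  eq a b = 𝟙 (a =ᶠ b)
  lt a b = 𝟙 (toℕ a <ᵇ toℕ b)
  distrib : ∀ x y z u → (x + (y + z)) * u ≡ x * u + (y * u + z * u)
  distrib = solve-∀

∑∑-shapes : (w : ℕ) (ℓ : Fin w → ℕ) (h : Point w ℓ → Point w ℓ → ℕ) →
  ∑[ p ∈ points w ℓ ] ∑[ q ∈ points w ℓ ] h p q ≡ ∑[ sh ∈ shapes w ℓ ] ∑-cube sh h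
∑∑-shapes zero    ℓ h = refl
∑∑-shapes (suc w) ℓ h = begin
  ∑[ p ∈ points (suc w) ℓ ] ∑[ q ∈ points (suc w) ℓ ] h p q
    ≡⟨ ∑-points-suc w ℓ (λ p → ∑[ q ∈ points (suc w) ℓ ] h p q) ⟩
  ∑[ a ∈ C ] ∑[ p ∈ P′ ] ∑[ q ∈ points (suc w) ℓ ] h (a ∷ p) q
    ≡⟨ ∑-cong C (λ a → ∑-cong P′ (λ p → ∑-points-suc w ℓ (h (a ∷ p)))) ⟩
  ∑[ a ∈ C ] ∑[ p ∈ P′ ] ∑[ b ∈ C ] ∑[ q ∈ P′ ] h (a ∷ p) (b ∷ q)
    ≡⟨ ∑-cong C (λ a → ∑-swap P′ C _) ⟩
  ∑[ a ∈ C ] ∑[ b ∈ C ] ∑[ p ∈ P′ ] ∑[ q ∈ P′ ] h (a ∷ p) (b ∷ q)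
    ≡⟨ ∑-cong C (λ a → ∑-cong C (λ b → ∑∑-shapes w (ℓ ∘ suc) (λ p q → h (a ∷ p) (b ∷ q)))) ⟩
  ∑[ a ∈ C ] ∑[ b ∈ C ] R a b
    ≡⟨ ∑∑-split-diagonal (suc (ℓ zero)) R ⟩
  ∑[ a ∈ C ] R a a + ∑[ a ∈ C ] ∑[ b ∈ C ] (𝟙 (toℕ a <ᵇ toℕ b) * (R a b + R b a))
    ≡⟨ cong₂ _+_ (∑-map C same T) (∑-cong C (λ a → ∑-cong C (λ b → ∑-strict a b T _ (T-apart a b)))) ⟨
  ∑ (map same C) T + ∑[ a ∈ C ] ∑[ b ∈ C ] ∑ (strict a b) T
    ≡⟨ cong (∑ (map same C) T +_) (trans (∑-concatMap C (λ a → concatMap (strict a) C) T) (∑-cong C (λ a → ∑-concatMap C (strict a) T))) ⟨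
  ∑ (map same C) T + ∑ (concatMap (λ a → concatMap (strict a) C) C) T
    ≡⟨ ∑-++ (map same C) (concatMap (λ a → concatMap (strict a) C) C) T ⟨
  ∑[ g ∈ gaps (suc (ℓ zero)) ] T g
    ≡⟨ trans (∑-concatMap (gaps (suc (ℓ zero))) (λ g → map (g ∷_) S′) (λ sh → ∑-cube sh h))
             (∑-cong (gaps (suc (ℓ zero))) (λ g → ∑-map S′ (g ∷_) (λ sh → ∑-cube sh h))) ⟨
  ∑[ sh ∈ shapes (suc w) ℓ ] ∑-cube sh h ∎
  where
  open ≡-Reasoning
  C  = allFin (suc (ℓ zero))
  P′ = points w (ℓ ∘ suc)
  S′ = shapes w (ℓ ∘ suc)
  R : Fin (suc (ℓ zero)) → Fin (suc (ℓ zero)) → ℕ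
  R a b = ∑[ sh ∈ S′ ] ∑-cube sh (λ p q → h (a ∷ p) (b ∷ q))
  T : Gap (suc (ℓ zero)) → ℕ
  T g = ∑[ sh ∈ S′ ] ∑-cube (g ∷ sh) h
  T-apart : ∀ a b a<b → T (apart a b a<b) ≡ R a b + R b a
  T-apart a b a<b = trans (∑-cong S′ (λ sh → ∑-cube-suc (dim sh) _)) (∑-+ S′ _ _)

distance : Point w ℓ → Point w ℓ → ℕ
distance []      []      = 0
distance (a ∷ p) (b ∷ q) = 𝟙 (not (a =ᶠ b)) + distance p q

distance-self : (p : Point w ℓ) → distance p p ≡ 0
distance-self []      = refl
distance-self (a ∷ p) rewrite =ᶠ-refl a = distance-self p

distance≡0⇒≡ : (p q : Point w ℓ) → distance p q ≡ 0 → p ≡ q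
distance≡0⇒≡ []      []      _ = refl
distance≡0⇒≡ (a ∷ p) (b ∷ q) d≡0 with a =ᶠ b in a=b
... | true = cong₂ _∷_ (=ᶠ-sound a b a=b) (distance≡0⇒≡ p q d≡0)

=ᵖ≡distance≡ᵇ0 : (p q : Point w ℓ) → (p =ᵖ q) ≡ (distance p q ≡ᵇ 0)
=ᵖ≡distance≡ᵇ0 []      []      = refl
=ᵖ≡distance≡ᵇ0 (a ∷ p) (b ∷ q) with a =ᶠ b
... | true  = =ᵖ≡distance≡ᵇ0 p q
... | false = refl

distance-pair : (sh : Shape w ℓ) (σ : Vec Bool (dim sh)) → distance (proj₁ (pair sh σ)) (proj₂ (pair sh σ)) ≡ dim sh
distance-pair []                   []          = refl
distance-pair (same a ∷ sh)        σ           rewrite =ᶠ-refl a = distance-pair sh σ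
distance-pair (apart a b a<b ∷ sh) (true ∷ σ)  rewrite <⇒=ᶠ≡false a b a<b = cong suc (distance-pair sh σ)
distance-pair (apart a b a<b ∷ sh) (false ∷ σ) rewrite =ᶠ-sym b a | <⇒=ᶠ≡false a b a<b = cong suc (distance-pair sh σ)

pair-diagonal : (sh : Shape w ℓ) (σ : Vec Bool (dim sh)) → dim sh ≡ 0 → proj₁ (pair sh σ) ≡ proj₂ (pair sh σ)
pair-diagonal sh σ dim≡0 = distance≡0⇒≡ _ _ (trans (distance-pair sh σ) dim≡0)

pair-offDiagonal : (sh : Shape w ℓ) (σ : Vec Bool (dim sh)) → 0 < dim sh → proj₁ (pair sh σ) ≢ proj₂ (pair sh σ)
pair-offDiagonal sh σ 0<dim P≡Q = <-irrefl (sym dim≡0) 0<dim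
  where
  Q = proj₂ (pair sh σ)
  dim≡0 : dim sh ≡ 0
  dim≡0 = trans (sym (distance-pair sh σ)) (trans (cong (λ p → distance p Q) P≡Q) (distance-self Q))

pair-not : (sh : Shape w ℓ) (σ : Vec Bool (dim sh)) →
  proj₁ (pair sh (Vec.map not σ)) ≡ proj₂ (pair sh σ) × proj₂ (pair sh (Vec.map not σ)) ≡ proj₁ (pair sh σ)
pair-not []                 []          = refl , refl
pair-not (same a ∷ sh)      σ           = let e₁ , e₂ = pair-not sh σ in cong (a ∷_) e₁ , cong (a ∷_) e₂
pair-not (apart a b _ ∷ sh) (true ∷ σ)  = let e₁ , e₂ = pair-not sh σ in cong (b ∷_) e₁ , cong (a ∷_) e₂
pair-not (apart a b _ ∷ sh) (false ∷ σ) = let e₁ , e₂ = pair-not sh σ in cong (a ∷_) e₁ , cong (b ∷_) e₂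

pair-mono : (sh : Shape w ℓ) {σ τ : Vec Bool (dim sh)} → Pointwise Bool._≤_ σ τ →
  proj₁ (pair sh τ) ≼ proj₁ (pair sh σ) × proj₂ (pair sh σ) ≼ proj₂ (pair sh τ)
pair-mono []                   []             = _ , _
pair-mono (same a ∷ sh)        σ≤τ            = let le₁ , le₂ = pair-mono sh σ≤τ in (≤-refl , le₁) , (≤-refl , le₂)
pair-mono (apart a b a<b ∷ sh) (f≤t ∷ σ≤τ)    = let le₁ , le₂ = pair-mono sh σ≤τ in (<⇒≤ a<b , le₁) , (<⇒≤ a<b , le₂)
pair-mono (apart a b a<b ∷ sh) (b≤b {true}  ∷ σ≤τ) = let le₁ , le₂ = pair-mono sh σ≤τ in (≤-refl , le₁) , (≤-refl , le₂)
pair-mono (apart a b a<b ∷ sh) (b≤b {false} ∷ σ≤τ) = let le₁ , le₂ = pair-mono sh σ≤τ in (≤-refl , le₁) , (≤-refl , le₂)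

-- The upper bound

farPairs : (w : ℕ) (ℓ : Fin w → ℕ) → ℕ
farPairs w ℓ = ∑[ p ∈ points w ℓ ] ∑[ q ∈ points w ℓ ] 𝟙 (1 <ᵇ distance p q)

discordant : (r₁ r₂ : Point w ℓ → ℕ) → Point w ℓ → Point w ℓ → Bool
discordant r₁ r₂ p q = (r₁ p <ᵇ r₁ q) xor (r₂ p <ᵇ r₂ q)

discordant-diagonal : (r₁ r₂ : Point w ℓ → ℕ) (p : Point w ℓ) → discordant r₁ r₂ p p ≡ false
discordant-diagonal r₁ r₂ p rewrite n<ᵇn≡false (r₁ p) | n<ᵇn≡false (r₂ p) = refl

<ᵇ-flip-injective : (r : Point w ℓ → ℕ) → (∀ p q → r p ≡ r q → p ≡ q) →
  ∀ p q → p ≢ q → (r q <ᵇ r p) ≡ not (r p <ᵇ r q)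
<ᵇ-flip-injective r injective p q p≢q = <ᵇ-flip (p≢q ∘ injective p q)

𝟙-discordant : {r₁ r₂ : Point w ℓ → ℕ} → IsRanking r₁ → IsRanking r₂ → ∀ p q →
  𝟙 (discordant r₁ r₂ p q) ≡ 𝟙 (inverted r₁ r₂ p q) + 𝟙 (inverted r₁ r₂ q p)
𝟙-discordant {r₁ = r₁} {r₂} isR₁ isR₂ p q with p =ᵖ q in p=q
... | true rewrite =ᵖ-sound p q p=q | n<ᵇn≡false (r₁ q) | n<ᵇn≡false (r₂ q) = refl
... | false rewrite <ᵇ-flip-injective r₁ (IsRanking.injective isR₁) p q (=ᵖ≡false⇒≢ p q p=q)
                  | <ᵇ-flip-injective r₂ (IsRanking.injective isR₂) p q (=ᵖ≡false⇒≢ p q p=q) =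
  table (r₁ p <ᵇ r₁ q) (r₂ p <ᵇ r₂ q)
  where
  table : ∀ x y → 𝟙 (x xor y) ≡ 𝟙 (x ∧ not y) + 𝟙 (not x ∧ y)
  table true  true  = refl
  table true  false = refl
  table false true  = refl
  table false false = refl

∑∑-discordant : {r₁ r₂ : Point w ℓ → ℕ} → IsRanking r₁ → IsRanking r₂ →
  ∑[ p ∈ points w ℓ ] ∑[ q ∈ points w ℓ ] 𝟙 (discordant r₁ r₂ p q) ≡ 2 * inversions r₁ r₂
∑∑-discordant {w} {ℓ} {r₁} {r₂} isR₁ isR₂ = begin
  ∑[ p ∈ P ] ∑[ q ∈ P ] 𝟙 (discordant r₁ r₂ p q)
    ≡⟨ ∑-cong P (λ p → trans (∑-cong P (𝟙-discordant isR₁ isR₂ p)) (∑-+ P _ _)) ⟩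
  ∑[ p ∈ P ] (∑[ q ∈ P ] inv p q + ∑[ q ∈ P ] inv q p)
    ≡⟨ ∑-+ P _ _ ⟩
  inversions r₁ r₂ + ∑[ p ∈ P ] ∑[ q ∈ P ] inv q p
    ≡⟨ cong (inversions r₁ r₂ +_) (trans (∑-swap P P (λ p q → inv q p)) (sym (+-identityʳ _))) ⟩
  2 * inversions r₁ r₂ ∎
  where
  open ≡-Reasoning
  P = points w ℓ
  inv : Point w ℓ → Point w ℓ → ℕ
  inv p q = 𝟙 (inverted r₁ r₂ p q)

∑-cube-far : (sh : Shape w ℓ) → ∑-cube sh (λ p q → 𝟙 (1 <ᵇ distance p q)) ≡ 2 ^ dim sh * 𝟙 (1 <ᵇ dim sh)
∑-cube-far sh = begin
  ∑[ σ ∈ cube (dim sh) ] 𝟙 (1 <ᵇ distance (proj₁ (pair sh σ)) (proj₂ (pair sh σ)))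
    ≡⟨ ∑-cong (cube (dim sh)) (λ σ → cong (λ d → 𝟙 (1 <ᵇ d)) (distance-pair sh σ)) ⟩
  ∑[ σ ∈ cube (dim sh) ] 𝟙 (1 <ᵇ dim sh)
    ≡⟨ ∑-const (cube (dim sh)) _ ⟩
  length (cube (dim sh)) * 𝟙 (1 <ᵇ dim sh)
    ≡⟨ cong (_* 𝟙 (1 <ᵇ dim sh)) (length-cube (dim sh)) ⟩
  2 ^ dim sh * 𝟙 (1 <ᵇ dim sh) ∎
  where open ≡-Reasoning

-- On the cube of a shape, "r ranks the first point of the pair below the second" is monotone,
-- and self-dual as soon as the two points differ.
cube-bound : {r₁ r₂ : Point w ℓ → ℕ} → IsRanking r₁ → IsRanking r₂ → (sh : Shape w ℓ) →
  2 * ∑-cube sh (λ p q → 𝟙 (discordant r₁ r₂ p q)) ≤ ∑-cube sh (λ p q → 𝟙 (1 <ᵇ distance p q))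
cube-bound {r₁ = r₁} {r₂} isR₁ isR₂ sh with dim sh ≟ 0
... | yes dim≡0 = subst (_≤ ∑-cube sh (λ p q → 𝟙 (1 <ᵇ distance p q))) (sym (cong (2 *_) on-diagonal)) z≤n
  where
  on-diagonal : ∑-cube sh (λ p q → 𝟙 (discordant r₁ r₂ p q)) ≡ 0
  on-diagonal = trans (∑-cong (cube (dim sh)) diagonal-term) (∑-zero (cube (dim sh)))
    where
    diagonal-term : ∀ σ → 𝟙 (discordant r₁ r₂ (proj₁ (pair sh σ)) (proj₂ (pair sh σ))) ≡ 0
    diagonal-term σ rewrite pair-diagonal sh σ dim≡0 | discordant-diagonal r₁ r₂ (proj₂ (pair sh σ)) = refl
... | no dim≢0 = subst (2 * ∑-cube sh (λ p q → 𝟙 (discordant r₁ r₂ p q)) ≤_) (sym (∑-cube-far sh))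
  (#xor-bound (below r₁) (below r₂) (below-mono isR₁) (below-selfDual isR₁) (below-mono isR₂) (below-selfDual isR₂))
  where
  below : (Point _ _ → ℕ) → Vec Bool (dim sh) → Bool
  below r σ = r (proj₁ (pair sh σ)) <ᵇ r (proj₂ (pair sh σ))
  below-mono : ∀ {r} → IsRanking r → Monotone (below r)
  below-mono {r} isR {σ} {τ} σ≤τ = ≤-from-≡true (λ lt → <⇒<ᵇ≡true (begin-strict
    r (proj₁ (pair sh τ)) ≤⟨ IsRanking.monotone isR _ _ (proj₁ (pair-mono sh σ≤τ)) ⟩
    r (proj₁ (pair sh σ)) <⟨ <ᵇ≡true⇒< _ _ lt ⟩
    r (proj₂ (pair sh σ)) ≤⟨ IsRanking.monotone isR _ _ (proj₂ (pair-mono sh σ≤τ)) ⟩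
    r (proj₂ (pair sh τ)) ∎))
    where open ≤-Reasoning
  below-selfDual : ∀ {r} → IsRanking r → SelfDual (below r)
  below-selfDual {r} isR σ rewrite proj₁ (pair-not sh σ) | proj₂ (pair-not sh σ) =
    <ᵇ-flip-injective r (IsRanking.injective isR) _ _ (pair-offDiagonal sh σ (n≢0⇒n>0 dim≢0))

inversions-bound : {r₁ r₂ : Point w ℓ → ℕ} → IsRanking r₁ → IsRanking r₂ → 4 * inversions r₁ r₂ ≤ farPairs w ℓ
inversions-bound {w} {ℓ} {r₁} {r₂} isR₁ isR₂ = begin
  4 * inversions r₁ r₂
    ≡⟨ *-assoc 2 2 (inversions r₁ r₂) ⟩
  2 * (2 * inversions r₁ r₂)
    ≡⟨ cong (2 *_) (∑∑-discordant isR₁ isR₂) ⟨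
  2 * ∑[ p ∈ points w ℓ ] ∑[ q ∈ points w ℓ ] 𝟙 (discordant r₁ r₂ p q)
    ≡⟨ cong (2 *_) (∑∑-shapes w ℓ _) ⟩
  2 * ∑[ sh ∈ shapes w ℓ ] ∑-cube sh (λ p q → 𝟙 (discordant r₁ r₂ p q))
    ≡⟨ ∑-*ˡ (shapes w ℓ) 2 _ ⟨
  ∑[ sh ∈ shapes w ℓ ] (2 * ∑-cube sh (λ p q → 𝟙 (discordant r₁ r₂ p q)))
    ≤⟨ ∑-mono (shapes w ℓ) (cube-bound isR₁ isR₂) ⟩
  ∑[ sh ∈ shapes w ℓ ] ∑-cube sh (λ p q → 𝟙 (1 <ᵇ distance p q))
    ≡⟨ ∑∑-shapes w ℓ _ ⟨
  farPairs w ℓ ∎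
  where open ≤-Reasoning

-- The lexicographic and colexicographic extensions

index : (A → A → Bool) → List A → A → ℕ
index _==_ []       x = 0
index _==_ (y ∷ ys) x = if y == x then 0 else suc (index _==_ ys x)

module _ (_==_ : A → A → Bool) (==-refl : ∀ x → (x == x) ≡ true) where

  index-< : {xs : List A} {x : A} → x ∈ xs → index _==_ xs x < length xs
  index-< {y ∷ xs} {x} x∈ with y == x in y=x
  ... | true = s≤s z≤n
  index-< {y ∷ xs} {x} (here refl) | false with () ← trans (sym y=x) (==-refl x)
  index-< {y ∷ xs} {x} (there x∈) | false = s≤s (index-< x∈)

  index-++ˡ : (xs ys : List A) {x : A} → x ∈ xs → index _==_ (xs ++ ys) x ≡ index _==_ xs x
  index-++ˡ (y ∷ xs) ys {x} x∈ with y == x in y=x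
  ... | true = refl
  index-++ˡ (y ∷ xs) ys {x} (here refl) | false with () ← trans (sym y=x) (==-refl x)
  index-++ˡ (y ∷ xs) ys {x} (there x∈) | false = cong suc (index-++ˡ xs ys x∈)

  module _ (==-sound : ∀ x y → (x == y) ≡ true → x ≡ y) where

    index-injective : {xs : List A} {x y : A} → x ∈ xs → y ∈ xs → index _==_ xs x ≡ index _==_ xs y → x ≡ y
    index-injective {z ∷ xs} {x} {y} x∈ y∈ eq with z == x in z=x | z == y in z=y
    ... | true  | true  = trans (sym (==-sound z x z=x)) (==-sound z y z=y)
    index-injective {z ∷ xs} {x} {y} (here refl)  y∈          eq | false | _
      with () ← trans (sym z=x) (==-refl x)
    index-injective {z ∷ xs} {x} {y} x∈           (here refl) eq | _     | false
      with () ← trans (sym z=y) (==-refl y)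
    index-injective {z ∷ xs} {x} {y} (there x∈)   (there y∈)  eq | false | false =
      index-injective x∈ y∈ (suc-injective eq)

index-++ʳ : (_==_ : A → A → Bool) (xs ys : List A) {x : A} → All (λ y → (y == x) ≡ false) xs →
  index _==_ (xs ++ ys) x ≡ length xs + index _==_ ys x
index-++ʳ _==_ []       ys []            = refl
index-++ʳ _==_ (y ∷ xs) ys (y≠x ∷ xs≠x) rewrite y≠x = cong suc (index-++ʳ _==_ xs ys xs≠x)

index-map : (_=A_ : A → A → Bool) (_=B_ : B → B → Bool) (f : A → B) (xs : List A) (x : A) →
  (∀ y → (f y =B f x) ≡ (y =A x)) → index _=B_ (map f xs) (f x) ≡ index _=A_ xs x
index-map _=A_ _=B_ f []       x f-resp = refl
index-map _=A_ _=B_ f (y ∷ xs) x f-resp rewrite f-resp y | index-map _=A_ _=B_ f xs x f-resp = refl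

index-concatMap : (_=A_ : A → A → Bool) (_=B_ : B → B → Bool) →
  (∀ x y → (x =A y) ≡ true → x ≡ y) → (∀ y → (y =B y) ≡ true) →
  (g : A → List B) (M : ℕ) → (∀ x → length (g x) ≡ M) →
  (x : A) (y : B) → y ∈ g x → (∀ x′ → (x′ =A x) ≡ false → All (λ y′ → (y′ =B y) ≡ false) (g x′)) →
  (xs : List A) → x ∈ xs → index _=B_ (concatMap g xs) y ≡ index _=A_ xs x * M + index _=B_ (g x) y
index-concatMap _=A_ _=B_ =A-sound =B-refl g M |g|≡M x y y∈gx separated (x′ ∷ xs) x∈ with x′ =A x in x′=x
... | true rewrite =A-sound x′ x x′=x = index-++ˡ _=B_ =B-refl (g x) (concatMap g xs) y∈gx
index-concatMap _=A_ _=B_ =A-sound =B-refl g M |g|≡M x y y∈gx separated (x′ ∷ xs) (here refl) | false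
  with () ← trans (sym (All.lookup (separated x x′=x) y∈gx)) (=B-refl y)
index-concatMap _=A_ _=B_ =A-sound =B-refl g M |g|≡M x y y∈gx separated (x′ ∷ xs) (there x∈) | false = begin
  index _=B_ (g x′ ++ concatMap g xs) y
    ≡⟨ index-++ʳ _=B_ (g x′) (concatMap g xs) (separated x′ x′=x) ⟩
  length (g x′) + index _=B_ (concatMap g xs) y
    ≡⟨ cong₂ _+_ (|g|≡M x′) (index-concatMap _=A_ _=B_ =A-sound =B-refl g M |g|≡M x y y∈gx separated xs x∈) ⟩
  M + (index _=A_ xs x * M + index _=B_ (g x) y)
    ≡⟨ +-assoc M _ _ ⟨
  suc (index _=A_ xs x) * M + index _=B_ (g x) y ∎
  where open ≡-Reasoning

index-allFin : (a : Fin m) → index _=ᶠ_ (allFin m) a ≡ toℕ a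
index-allFin zero    = refl
index-allFin {suc m} (suc a) = cong suc (begin
  index _=ᶠ_ (tabulate suc) (suc a)        ≡⟨ cong (λ xs → index _=ᶠ_ xs (suc a)) (map-tabulate (λ i → i) suc) ⟨
  index _=ᶠ_ (map suc (allFin m)) (suc a)  ≡⟨ index-map _=ᶠ_ _=ᶠ_ suc (allFin m) a (λ _ → refl) ⟩
  index _=ᶠ_ (allFin m) a                  ≡⟨ index-allFin a ⟩
  toℕ a                                    ∎)
  where open ≡-Reasoning

-- Points listed with the last coordinate most significant.
pointsʳ : (w : ℕ) (ℓ : Fin w → ℕ) → List (Point w ℓ)
pointsʳ zero    ℓ = [] ∷ []
pointsʳ (suc w) ℓ = concatMap (λ p → map (_∷ p) (allFin (suc (ℓ zero)))) (pointsʳ w (ℓ ∘ suc))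

∈-pointsʳ : (p : Point w ℓ) → p ∈ pointsʳ w ℓ
∈-pointsʳ []      = here refl
∈-pointsʳ {suc w} {ℓ} (a ∷ p) =
  ∈-concatMap⁺ (λ q → map (_∷ q) (allFin (suc (ℓ zero)))) (lose (∈-pointsʳ p) (∈-map⁺ (_∷ p) (∈-allFin a)))

lexRank colexRank : (w : ℕ) (ℓ : Fin w → ℕ) → Point w ℓ → ℕ
lexRank   w ℓ = index _=ᵖ_ (points w ℓ)
colexRank w ℓ = index _=ᵖ_ (pointsʳ w ℓ)

lexRank-∷ : (a : Fin (suc (ℓ zero))) (p : Point w (ℓ ∘ suc)) →
  lexRank (suc w) ℓ (a ∷ p) ≡ toℕ a * length (points w (ℓ ∘ suc)) + lexRank w (ℓ ∘ suc) p
lexRank-∷ {w = w} {ℓ = ℓ} a p = begin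
  index _=ᵖ_ (concatMap block (allFin (suc (ℓ zero)))) (a ∷ p)
    ≡⟨ index-concatMap _=ᶠ_ _=ᵖ_ =ᶠ-sound =ᵖ-refl block (length P′) (λ b → length-map (b ∷_) P′)
         a (a ∷ p) (∈-map⁺ (a ∷_) (∈-points p)) separated (allFin _) (∈-allFin a) ⟩
  index _=ᶠ_ (allFin _) a * length P′ + index _=ᵖ_ (block a) (a ∷ p)
    ≡⟨ cong₂ (λ i j → i * length P′ + j) (index-allFin a)
             (index-map _=ᵖ_ _=ᵖ_ (_∷_ {ℓ = ℓ} a) P′ p (λ q → cong (_∧ (q =ᵖ p)) (=ᶠ-refl a))) ⟩
  toℕ a * length P′ + lexRank w (ℓ ∘ suc) p ∎
  where
  open ≡-Reasoning
  P′ = points w (ℓ ∘ suc)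
  block : Fin (suc (ℓ zero)) → List (Point (suc w) ℓ)
  block b = map (b ∷_) P′
  separated : ∀ b → (b =ᶠ a) ≡ false → All (λ y → (y =ᵖ (a ∷ p)) ≡ false) (block b)
  separated b b≠a = map⁺ (All.universal (λ q → cong (_∧ (q =ᵖ p)) b≠a) P′)

colexRank-∷ : (a : Fin (suc (ℓ zero))) (p : Point w (ℓ ∘ suc)) →
  colexRank (suc w) ℓ (a ∷ p) ≡ colexRank w (ℓ ∘ suc) p * suc (ℓ zero) + toℕ a
colexRank-∷ {w = w} {ℓ = ℓ} a p = begin
  index _=ᵖ_ (concatMap block (pointsʳ w (ℓ ∘ suc))) (a ∷ p)
    ≡⟨ index-concatMap _=ᵖ_ _=ᵖ_ =ᵖ-sound =ᵖ-refl block (suc (ℓ zero)) |block|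
         p (a ∷ p) (∈-map⁺ (_∷ p) (∈-allFin a)) separated (pointsʳ w (ℓ ∘ suc)) (∈-pointsʳ p) ⟩
  colexRank w (ℓ ∘ suc) p * suc (ℓ zero) + index _=ᵖ_ (block p) (a ∷ p)
    ≡⟨ cong (colexRank w (ℓ ∘ suc) p * suc (ℓ zero) +_)
            (trans (index-map _=ᶠ_ _=ᵖ_ (λ b → _∷_ {ℓ = ℓ} b p) (allFin _) a (λ b → cong ((b =ᶠ a) ∧_) (=ᵖ-refl p)
                                                                                ∙ ∧-identityʳ (b =ᶠ a)))
                   (index-allFin a)) ⟩
  colexRank w (ℓ ∘ suc) p * suc (ℓ zero) + toℕ a ∎
  where
  open ≡-Reasoning
  _∙_ = trans
  block : Point w (ℓ ∘ suc) → List (Point (suc w) ℓ)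
  block q = map (λ b → b ∷ q) (allFin (suc (ℓ zero)))
  |block| : ∀ q → length (block q) ≡ suc (ℓ zero)
  |block| q = trans (length-map (λ b → _∷_ {ℓ = ℓ} b q) (allFin _)) (length-tabulate (λ i → i))
  separated : ∀ q → (q =ᵖ p) ≡ false → All (λ y → (y =ᵖ (a ∷ p)) ≡ false) (block q)
  separated q q≠p = map⁺ (All.universal (λ b → cong ((b =ᶠ a) ∧_) q≠p ∙ ∧-zeroʳ (b =ᶠ a)) (allFin _))

<-mixedRadix : ∀ M x y i j → x < y → i < M → x * M + i < y * M + j
<-mixedRadix M x y i j x<y i<M = begin-strict
  x * M + i <⟨ +-monoʳ-< (x * M) i<M ⟩
  x * M + M ≡⟨ +-comm (x * M) M ⟩
  suc x * M ≤⟨ *-monoˡ-≤ M x<y ⟩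
  y * M     ≤⟨ m≤m+n (y * M) j ⟩
  y * M + j ∎
  where open ≤-Reasoning

<ᵇ-mixedRadix : ∀ M x y i j → i < M → j < M →
  (x * M + i <ᵇ y * M + j) ≡ (x <ᵇ y) ∨ ((x ≡ᵇ y) ∧ (i <ᵇ j))
<ᵇ-mixedRadix M x y i j i<M j<M with <-cmp x y
... | tri< x<y _ _ rewrite <⇒<ᵇ≡true x<y = <⇒<ᵇ≡true (<-mixedRadix M x y i j x<y i<M)
... | tri≈ _ refl _ rewrite n<ᵇn≡false x | ≡ᵇ-refl x =
  bool-ext (λ lt → <⇒<ᵇ≡true (+-cancelˡ-< (x * M) i j (<ᵇ≡true⇒< _ _ lt)))
           (λ lt → <⇒<ᵇ≡true (+-monoʳ-< (x * M) (<ᵇ≡true⇒< i j lt)))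
... | tri> _ x≢y y<x rewrite ≮⇒<ᵇ≡false (<⇒≯ y<x) | ≢⇒≡ᵇ≡false x≢y =
  ≮⇒<ᵇ≡false (<⇒≯ (<-mixedRadix M y x j i y<x j<M))

lexRank-<ᵇ : (a b : Fin (suc (ℓ zero))) (p q : Point w (ℓ ∘ suc)) →
  (lexRank (suc w) ℓ (a ∷ p) <ᵇ lexRank (suc w) ℓ (b ∷ q)) ≡
  (toℕ a <ᵇ toℕ b) ∨ ((a =ᶠ b) ∧ (lexRank w (ℓ ∘ suc) p <ᵇ lexRank w (ℓ ∘ suc) q))
lexRank-<ᵇ {w = w} {ℓ = ℓ} a b p q rewrite lexRank-∷ {ℓ = ℓ} a p | lexRank-∷ {ℓ = ℓ} b q =
  <ᵇ-mixedRadix (length (points w (ℓ ∘ suc))) (toℕ a) (toℕ b) _ _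
    (index-< _=ᵖ_ =ᵖ-refl (∈-points p)) (index-< _=ᵖ_ =ᵖ-refl (∈-points q))

colexRank-≡ᵇ : (p q : Point w ℓ) → (colexRank w ℓ p ≡ᵇ colexRank w ℓ q) ≡ (p =ᵖ q)
colexRank-≡ᵇ {w} {ℓ} p q = bool-ext
  (λ eq → subst (λ r → (p =ᵖ r) ≡ true)
                (index-injective _=ᵖ_ =ᵖ-refl =ᵖ-sound (∈-pointsʳ p) (∈-pointsʳ q) (≡ᵇ≡true⇒≡ _ _ eq)) (=ᵖ-refl p))
  (λ p=q → subst (λ r → (colexRank w ℓ p ≡ᵇ colexRank w ℓ r) ≡ true) (=ᵖ-sound p q p=q) (≡ᵇ-refl (colexRank w ℓ p)))

colexRank-<ᵇ : (a b : Fin (suc (ℓ zero))) (p q : Point w (ℓ ∘ suc)) →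
  (colexRank (suc w) ℓ (a ∷ p) <ᵇ colexRank (suc w) ℓ (b ∷ q)) ≡
  (colexRank w (ℓ ∘ suc) p <ᵇ colexRank w (ℓ ∘ suc) q) ∨ ((p =ᵖ q) ∧ (toℕ a <ᵇ toℕ b))
colexRank-<ᵇ {w = w} {ℓ = ℓ} a b p q rewrite colexRank-∷ {ℓ = ℓ} a p | colexRank-∷ {ℓ = ℓ} b q | sym (colexRank-≡ᵇ p q) =
  <ᵇ-mixedRadix (suc (ℓ zero)) (colexRank w (ℓ ∘ suc) p) (colexRank w (ℓ ∘ suc) q) (toℕ a) (toℕ b) (toℕ<n a) (toℕ<n b)

lexRank-mono : (p q : Point w ℓ) → p ≼ q → (lexRank w ℓ q <ᵇ lexRank w ℓ p) ≡ false
lexRank-mono             []      []      _           = refl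
lexRank-mono {ℓ = ℓ} (a ∷ p) (b ∷ q) (a≤b , p≼q)
  rewrite lexRank-<ᵇ {ℓ = ℓ} b a q p | ≮⇒<ᵇ≡false (≤⇒≯ a≤b) | lexRank-mono p q p≼q | ∧-zeroʳ (b =ᶠ a) = refl

colexRank-mono : (p q : Point w ℓ) → p ≼ q → (colexRank w ℓ q <ᵇ colexRank w ℓ p) ≡ false
colexRank-mono             []      []      _           = refl
colexRank-mono {ℓ = ℓ} (a ∷ p) (b ∷ q) (a≤b , p≼q)
  rewrite colexRank-<ᵇ {ℓ = ℓ} b a q p | ≮⇒<ᵇ≡false (≤⇒≯ a≤b) | colexRank-mono p q p≼q | ∧-zeroʳ (q =ᵖ p) = refl

∑-pointsʳ : (w : ℕ) (ℓ : Fin w → ℕ) (f : Point w ℓ → ℕ) → ∑ (pointsʳ w ℓ) f ≡ ∑ (points w ℓ) f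
∑-pointsʳ zero    ℓ f = refl
∑-pointsʳ (suc w) ℓ f = begin
  ∑ (pointsʳ (suc w) ℓ) f
    ≡⟨ ∑-concatMap (pointsʳ w (ℓ ∘ suc)) (λ p → map (_∷ p) C) f ⟩
  ∑[ p ∈ pointsʳ w (ℓ ∘ suc) ] ∑ (map (_∷ p) C) f
    ≡⟨ ∑-cong (pointsʳ w (ℓ ∘ suc)) (λ p → ∑-map C (_∷ p) f) ⟩
  ∑[ p ∈ pointsʳ w (ℓ ∘ suc) ] ∑[ a ∈ C ] f (a ∷ p)
    ≡⟨ ∑-pointsʳ w (ℓ ∘ suc) (λ p → ∑[ a ∈ C ] f (a ∷ p)) ⟩
  ∑[ p ∈ points w (ℓ ∘ suc) ] ∑[ a ∈ C ] f (a ∷ p)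
    ≡⟨ ∑-swap (points w (ℓ ∘ suc)) C (λ p a → f (a ∷ p)) ⟩
  ∑[ a ∈ C ] ∑[ p ∈ points w (ℓ ∘ suc) ] f (a ∷ p)
    ≡⟨ ∑-points-suc w ℓ f ⟨
  ∑ (points (suc w) ℓ) f ∎
  where
  open ≡-Reasoning
  C = allFin (suc (ℓ zero))

count-points : (p : Point w ℓ) → ∑[ q ∈ points w ℓ ] 𝟙 (p =ᵖ q) ≡ 1
count-points {w} {ℓ} p = trans (∑-cong (points w ℓ) (λ q → sym (*-identityʳ _))) (∑-δ p (λ _ → 1))

count≡0⇒absent : (p : Point w ℓ) (qs : List (Point w ℓ)) → ∑[ q ∈ qs ] 𝟙 (p =ᵖ q) ≡ 0 → All (p ≢_) qs
count≡0⇒absent p []       _     = []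
count≡0⇒absent p (q ∷ qs) none with p =ᵖ q in p=q
... | false = =ᵖ≡false⇒≢ p q p=q ∷ count≡0⇒absent p qs none

unique-fromCount : (ps : List (Point w ℓ)) → (∀ p → ∑[ q ∈ ps ] 𝟙 (p =ᵖ q) ≤ 1) → Unique ps
unique-fromCount []       _     = []
unique-fromCount (p ∷ ps) count =
  count≡0⇒absent p ps (n≤0⇒n≡0 (s≤s⁻¹ (subst (λ b → 𝟙 b + ∑[ q ∈ ps ] 𝟙 (p =ᵖ q) ≤ 1) (=ᵖ-refl p) (count p))))
  ∷ unique-fromCount ps (λ q → ≤-trans (m≤n+m _ (𝟙 (q =ᵖ p))) (count q))

toDownset-≐ᵇ : (p q : Point w ℓ) → (toDownset p ≐ᵇ toDownset q) ≡ (p =ᵖ q)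
toDownset-≐ᵇ p q = bool-ext
  (λ eq → subst (λ r → (p =ᵖ r) ≡ true) (toDownset-injective p q (≐ᵇ-sound (toDownset p) (toDownset q) eq)) (=ᵖ-refl p))
  (λ p=q → subst (λ r → (toDownset p ≐ᵇ toDownset r) ≡ true) (=ᵖ-sound p q p=q)
                 (≐ᵇ-complete (toDownset p) (toDownset p) (λ _ → refl)))

rank-map : (ps : List (Point w ℓ)) (p : Point w ℓ) → rank (map toDownset ps) p ≡ index _=ᵖ_ ps p
rank-map []       p = refl
rank-map (q ∷ ps) p rewrite toDownset-≐ᵇ q p | rank-map ps p = refl

lookup-map : (f : A → B) (xs : List A) (i : Fin (length (map f xs))) →
  ∃[ j ] (toℕ j ≡ toℕ i × lookup (map f xs) i ≡ f (lookup xs j))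
lookup-map f (x ∷ xs) zero    = zero , refl , refl
lookup-map f (x ∷ xs) (suc i) = let j , j≡i , eq = lookup-map f xs i in suc j , cong suc j≡i , eq

index-lookup : (ps : List (Point w ℓ)) → Unique ps → (j : Fin (length ps)) → index _=ᵖ_ ps (lookup ps j) ≡ toℕ j
index-lookup (p ∷ ps) unique zero rewrite =ᵖ-refl p = refl
index-lookup (p ∷ ps) (p∉ps ∷ unique) (suc j)
  rewrite ≢⇒=ᵖ≡false p (lookup ps j) (All.lookup p∉ps (∈-lookup j)) = cong suc (index-lookup ps unique j)

isLinearExtension-map : (ps : List (Point w ℓ)) → (∀ p → p ∈ ps) → Unique ps →
  (∀ p q → p ≼ q → (index _=ᵖ_ ps q <ᵇ index _=ᵖ_ ps p) ≡ false) → IsLinearExtension (map toDownset ps)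
isLinearExtension-map ps complete unique mono = record { covers = covers ; distinct = distinct ; monotone = monotone }
  where
  L = map toDownset ps
  covers : ∀ D → Any (D ≐_) L
  covers D = Any.map⁺ (Any.map (λ { refl x → sym (toDownset-toPoint D x) }) (complete (toPoint D)))
  point-at : ∀ i → Σ (Point _ _) (λ p → lookup L i ≡ toDownset p × index _=ᵖ_ ps p ≡ toℕ i)
  point-at i = let j , j≡i , eq = lookup-map toDownset ps i in lookup ps j , eq , trans (index-lookup ps unique j) j≡i
  distinct : ∀ i j → i Fin.< j → ¬ lookup L i ≐ lookup L j
  distinct i j i<j Lᵢ≐Lⱼ with point-at i | point-at j
  ... | p , Lᵢ≡p , p↦i | q , Lⱼ≡q , q↦j with toDownset-injective p q (subst₂ _≐_ Lᵢ≡p Lⱼ≡q Lᵢ≐Lⱼ)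
  ... | refl = <-irrefl (trans (sym p↦i) q↦j) i<j
  monotone : ∀ i j → lookup L i ⊆ lookup L j → i Fin.≤ j
  monotone i j Lᵢ⊆Lⱼ with point-at i | point-at j
  ... | p , Lᵢ≡p , p↦i | q , Lⱼ≡q , q↦j =
    subst₂ _≤_ p↦i q↦j (≮⇒≥ (λ q<p → true≢false (trans (sym (<⇒<ᵇ≡true q<p)) (mono p q p≼q))))
    where
    p≼q : p ≼ q
    p≼q = toDownset-reflects p q (subst₂ _⊆_ Lᵢ≡p Lⱼ≡q Lᵢ⊆Lⱼ)
    true≢false : true ≢ false
    true≢false ()

lexExtension colexExtension : (w : ℕ) (ℓ : Fin w → ℕ) → List (Downset w ℓ)
lexExtension   w ℓ = map toDownset (points w ℓ)
colexExtension w ℓ = map toDownset (pointsʳ w ℓ)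

lexExtension-isLinearExtension : (w : ℕ) (ℓ : Fin w → ℕ) → IsLinearExtension (lexExtension w ℓ)
lexExtension-isLinearExtension w ℓ =
  isLinearExtension-map (points w ℓ) ∈-points (unique-fromCount (points w ℓ) (≤-reflexive ∘ count-points)) lexRank-mono

colexExtension-isLinearExtension : (w : ℕ) (ℓ : Fin w → ℕ) → IsLinearExtension (colexExtension w ℓ)
colexExtension-isLinearExtension w ℓ =
  isLinearExtension-map (pointsʳ w ℓ) ∈-pointsʳ
    (unique-fromCount (pointsʳ w ℓ) (λ p → ≤-reflexive (trans (∑-pointsʳ w ℓ _) (count-points p)))) colexRank-mono

-- The two extensions attain the bound

-- Lex decides by the first coordinate, colex by the tails unless these coincide.
lexColex-apart : (a b : Fin (suc (ℓ zero))) → toℕ a < toℕ b → (p q : Point w (ℓ ∘ suc)) →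
  𝟙 (discordant (lexRank (suc w) ℓ) (colexRank (suc w) ℓ) (a ∷ p) (b ∷ q)) +
  𝟙 (discordant (lexRank (suc w) ℓ) (colexRank (suc w) ℓ) (b ∷ p) (a ∷ q)) ≡ 𝟙 (not (p =ᵖ q))
lexColex-apart {w = w} {ℓ = ℓ} a b a<b p q
  rewrite lexRank-<ᵇ {ℓ = ℓ} a b p q | colexRank-<ᵇ {ℓ = ℓ} a b p q
        | lexRank-<ᵇ {ℓ = ℓ} b a p q | colexRank-<ᵇ {ℓ = ℓ} b a p q
        | <⇒<ᵇ≡true a<b | ≮⇒<ᵇ≡false (<⇒≯ a<b) | =ᶠ-sym b a | <⇒=ᶠ≡false a b a<b
  with p =ᵖ q in p=q
... | true rewrite =ᵖ-sound p q p=q | n<ᵇn≡false (colexRank w (ℓ ∘ suc) q) = refl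
... | false = exactly-one (colexRank w (ℓ ∘ suc) p <ᵇ colexRank w (ℓ ∘ suc) q)
  where
  exactly-one : ∀ y → 𝟙 (true xor (y ∨ false)) + 𝟙 (false xor (y ∨ false)) ≡ 1
  exactly-one true  = refl
  exactly-one false = refl

lexColex-cube : (w : ℕ) (ℓ : Fin w → ℕ) (sh : Shape w ℓ) →
  2 * ∑-cube sh (λ p q → 𝟙 (discordant (lexRank w ℓ) (colexRank w ℓ) p q)) ≡ 2 ^ dim sh * 𝟙 (1 <ᵇ dim sh)
lexColex-cube zero    ℓ []            = refl
lexColex-cube (suc w) ℓ (same a ∷ sh) =
  trans (cong (2 *_) (∑-cong (cube (dim sh)) (λ σ → cong 𝟙 (tail (proj₁ (pair sh σ)) (proj₂ (pair sh σ))))))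
        (lexColex-cube w (ℓ ∘ suc) sh)
  where
  tail : ∀ p q → discordant (lexRank (suc w) ℓ) (colexRank (suc w) ℓ) (a ∷ p) (a ∷ q)
               ≡ discordant (lexRank w (ℓ ∘ suc)) (colexRank w (ℓ ∘ suc)) p q
  tail p q rewrite lexRank-<ᵇ {ℓ = ℓ} a a p q | colexRank-<ᵇ {ℓ = ℓ} a a p q | n<ᵇn≡false (toℕ a) | =ᶠ-refl a
                 | ∧-zeroʳ (p =ᵖ q) | ∨-identityʳ (colexRank w (ℓ ∘ suc) p <ᵇ colexRank w (ℓ ∘ suc) q) = refl
lexColex-cube (suc w) ℓ (apart a b a<b ∷ sh) = begin
  2 * ∑[ σ ∈ cube (suc (dim sh)) ] 𝟙 (δ (proj₁ (pair (apart a b a<b ∷ sh) σ)) (proj₂ (pair (apart a b a<b ∷ sh) σ)))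
    ≡⟨ cong (2 *_) (∑-cube-suc (dim sh) _) ⟩
  2 * (∑[ σ ∈ cube (dim sh) ] 𝟙 (δ (a ∷ P σ) (b ∷ Q σ)) + ∑[ σ ∈ cube (dim sh) ] 𝟙 (δ (b ∷ P σ) (a ∷ Q σ)))
    ≡⟨ cong (2 *_) (∑-+ (cube (dim sh)) _ _) ⟨
  2 * ∑[ σ ∈ cube (dim sh) ] (𝟙 (δ (a ∷ P σ) (b ∷ Q σ)) + 𝟙 (δ (b ∷ P σ) (a ∷ Q σ)))
    ≡⟨ cong (2 *_) (∑-cong (cube (dim sh)) (λ σ → lexColex-apart a b a<b (P σ) (Q σ))) ⟩
  2 * ∑[ σ ∈ cube (dim sh) ] 𝟙 (not (P σ =ᵖ Q σ))
    ≡⟨ cong (2 *_) (∑-cong (cube (dim sh)) (λ σ → cong 𝟙 (apart≡ σ))) ⟩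
  2 * ∑[ σ ∈ cube (dim sh) ] 𝟙 (0 <ᵇ dim sh)
    ≡⟨ cong (2 *_) (trans (∑-const (cube (dim sh)) _) (cong (_* 𝟙 (0 <ᵇ dim sh)) (length-cube (dim sh)))) ⟩
  2 * (2 ^ dim sh * 𝟙 (0 <ᵇ dim sh))
    ≡⟨ *-assoc 2 (2 ^ dim sh) _ ⟨
  2 ^ suc (dim sh) * 𝟙 (1 <ᵇ suc (dim sh)) ∎
  where
  open ≡-Reasoning
  δ = discordant (lexRank (suc w) ℓ) (colexRank (suc w) ℓ)
  P Q : Vec Bool (dim sh) → Point w (ℓ ∘ suc)
  P σ = proj₁ (pair sh σ)
  Q σ = proj₂ (pair sh σ)
  apart≡ : ∀ σ → not (P σ =ᵖ Q σ) ≡ (0 <ᵇ dim sh)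
  apart≡ σ rewrite =ᵖ≡distance≡ᵇ0 (P σ) (Q σ) | distance-pair sh σ with dim sh
  ... | zero  = refl
  ... | suc _ = refl

isRanking-cong : {r r′ : Point w ℓ → ℕ} → (∀ p → r p ≡ r′ p) → IsRanking r → IsRanking r′
isRanking-cong r≗r′ isR = record
  { injective = λ p q eq → IsRanking.injective isR p q (trans (r≗r′ p) (trans eq (sym (r≗r′ q))))
  ; monotone  = λ p q p≼q → subst₂ _≤_ (r≗r′ p) (r≗r′ q) (IsRanking.monotone isR p q p≼q)
  }

lexRank-isRanking : (w : ℕ) (ℓ : Fin w → ℕ) → IsRanking (lexRank w ℓ)
lexRank-isRanking w ℓ = isRanking-cong (rank-map (points w ℓ)) (rank-isRanking (lexExtension-isLinearExtension w ℓ))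

colexRank-isRanking : (w : ℕ) (ℓ : Fin w → ℕ) → IsRanking (colexRank w ℓ)
colexRank-isRanking w ℓ = isRanking-cong (rank-map (pointsʳ w ℓ)) (rank-isRanking (colexExtension-isLinearExtension w ℓ))

lexColex-inversions : (w : ℕ) (ℓ : Fin w → ℕ) → 4 * inversions (lexRank w ℓ) (colexRank w ℓ) ≡ farPairs w ℓ
lexColex-inversions w ℓ = begin
  4 * inversions (lexRank w ℓ) (colexRank w ℓ)
    ≡⟨ *-assoc 2 2 (inversions (lexRank w ℓ) (colexRank w ℓ)) ⟩
  2 * (2 * inversions (lexRank w ℓ) (colexRank w ℓ))
    ≡⟨ cong (2 *_) (∑∑-discordant (lexRank-isRanking w ℓ) (colexRank-isRanking w ℓ)) ⟨
  2 * ∑[ p ∈ points w ℓ ] ∑[ q ∈ points w ℓ ] disc p q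
    ≡⟨ cong (2 *_) (∑∑-shapes w ℓ disc) ⟩
  2 * ∑[ sh ∈ shapes w ℓ ] ∑-cube sh disc
    ≡⟨ ∑-*ˡ (shapes w ℓ) 2 (λ sh → ∑-cube sh disc) ⟨
  ∑[ sh ∈ shapes w ℓ ] (2 * ∑-cube sh disc)
    ≡⟨ ∑-cong (shapes w ℓ) (λ sh → trans (lexColex-cube w ℓ sh) (sym (∑-cube-far sh))) ⟩
  ∑[ sh ∈ shapes w ℓ ] ∑-cube sh (λ p q → 𝟙 (1 <ᵇ distance p q))
    ≡⟨ ∑∑-shapes w ℓ _ ⟨
  farPairs w ℓ ∎
  where
  open ≡-Reasoning
  disc : Point w ℓ → Point w ℓ → ℕ
  disc p q = 𝟙 (discordant (lexRank w ℓ) (colexRank w ℓ) p q)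

-- Counting pairs of points by distance

∑ℓ : (w : ℕ) → (Fin w → ℕ) → ℕ
∑ℓ w ℓ = ∑[ i ∈ allFin w ] ℓ i

distance-trichotomy : (d : ℕ) → 𝟙 (d ≡ᵇ 0) + 𝟙 (d ≡ᵇ 1) + 𝟙 (1 <ᵇ d) ≡ 1
distance-trichotomy zero          = refl
distance-trichotomy (suc zero)    = refl
distance-trichotomy (suc (suc d)) = refl

∑-≢ᶠ : (a : Fin (suc n)) → ∑[ b ∈ allFin (suc n) ] 𝟙 (not (a =ᶠ b)) ≡ n
∑-≢ᶠ {n} a = +-cancelˡ-≡ 1 _ n (begin
  1 + ∑[ b ∈ F ] 𝟙 (not (a =ᶠ b))                        ≡⟨ cong (_+ ∑[ b ∈ F ] 𝟙 (not (a =ᶠ b))) (∑-δᶠ a (λ _ → 1)) ⟨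
  ∑[ b ∈ F ] (𝟙 (a =ᶠ b) * 1) + ∑[ b ∈ F ] 𝟙 (not (a =ᶠ b)) ≡⟨ ∑-+ F (λ b → 𝟙 (a =ᶠ b) * 1) (λ b → 𝟙 (not (a =ᶠ b))) ⟨
  ∑[ b ∈ F ] (𝟙 (a =ᶠ b) * 1 + 𝟙 (not (a =ᶠ b)))          ≡⟨ ∑-cong F (λ b → trans (cong (_+ 𝟙 (not (a =ᶠ b))) (*-identityʳ _)) (𝟙-not (a =ᶠ b))) ⟩
  ∑[ b ∈ F ] 1                                            ≡⟨ trans (∑-one F) (length-tabulate (λ i → i)) ⟩
  suc n                                                   ∎)
  where
  open ≡-Reasoning
  F = allFin (suc n)

-- A point has ∑ᵢ ℓᵢ neighbours: in each chain i, the ℓᵢ other values of its i-th coordinate.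
neighbours : (p : Point w ℓ) → ∑[ q ∈ points w ℓ ] 𝟙 (distance p q ≡ᵇ 1) ≡ ∑ℓ w ℓ
neighbours         []      = refl
neighbours {suc w} {ℓ} (a ∷ p) = begin
  ∑[ q ∈ points (suc w) ℓ ] 𝟙 (distance (a ∷ p) q ≡ᵇ 1)
    ≡⟨ ∑-points-suc w ℓ _ ⟩
  ∑[ b ∈ F ] ∑[ q ∈ P′ ] 𝟙 (𝟙 (not (a =ᶠ b)) + distance p q ≡ᵇ 1)
    ≡⟨ ∑-cong F (λ b → trans (∑-cong P′ (λ q → split (a =ᶠ b) (distance p q)))
                             (∑-+ P′ (λ q → 𝟙 (a =ᶠ b) * 𝟙 (distance p q ≡ᵇ 1)) (λ q → 𝟙 (not (a =ᶠ b)) * 𝟙 (distance p q ≡ᵇ 0)))) ⟩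
  ∑[ b ∈ F ] (∑[ q ∈ P′ ] (𝟙 (a =ᶠ b) * 𝟙 (distance p q ≡ᵇ 1)) + ∑[ q ∈ P′ ] (𝟙 (not (a =ᶠ b)) * 𝟙 (distance p q ≡ᵇ 0)))
    ≡⟨ ∑-cong F (λ b → cong₂ _+_ (trans (∑-*ˡ P′ (𝟙 (a =ᶠ b)) (λ q → 𝟙 (distance p q ≡ᵇ 1))) (cong (𝟙 (a =ᶠ b) *_) (neighbours p)))
                                  (trans (∑-*ˡ P′ (𝟙 (not (a =ᶠ b))) (λ q → 𝟙 (distance p q ≡ᵇ 0))) (cong (𝟙 (not (a =ᶠ b)) *_) self))) ⟩
  ∑[ b ∈ F ] (𝟙 (a =ᶠ b) * ∑ℓ w (ℓ ∘ suc) + 𝟙 (not (a =ᶠ b)) * 1)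
    ≡⟨ ∑-+ F (λ b → 𝟙 (a =ᶠ b) * ∑ℓ w (ℓ ∘ suc)) (λ b → 𝟙 (not (a =ᶠ b)) * 1) ⟩
  ∑[ b ∈ F ] (𝟙 (a =ᶠ b) * ∑ℓ w (ℓ ∘ suc)) + ∑[ b ∈ F ] (𝟙 (not (a =ᶠ b)) * 1)
    ≡⟨ cong₂ _+_ (∑-δᶠ a (λ _ → ∑ℓ w (ℓ ∘ suc))) (trans (∑-cong F (λ b → *-identityʳ _)) (∑-≢ᶠ a)) ⟩
  ∑ℓ w (ℓ ∘ suc) + ℓ zero
    ≡⟨ +-comm _ (ℓ zero) ⟩
  ℓ zero + ∑ℓ w (ℓ ∘ suc)
    ≡⟨ ∑-allFin-suc ℓ ⟨
  ∑ℓ (suc w) ℓ ∎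
  where
  open ≡-Reasoning
  F  = allFin (suc (ℓ zero))
  P′ = points w (ℓ ∘ suc)
  split : ∀ e d → 𝟙 (𝟙 (not e) + d ≡ᵇ 1) ≡ 𝟙 e * 𝟙 (d ≡ᵇ 1) + 𝟙 (not e) * 𝟙 (d ≡ᵇ 0)
  split true  d       = sym (trans (+-identityʳ _) (+-identityʳ _))
  split false zero    = refl
  split false (suc d) = refl
  self : ∑[ q ∈ P′ ] 𝟙 (distance p q ≡ᵇ 0) ≡ 1
  self = trans (∑-cong P′ (λ q → cong 𝟙 (sym (=ᵖ≡distance≡ᵇ0 p q)))) (trans (∑-cong P′ (λ q → sym (*-identityʳ _))) (∑-δ p (λ _ → 1)))

∑-distance≡ᵇ0 : (p : Point w ℓ) → ∑[ q ∈ points w ℓ ] 𝟙 (distance p q ≡ᵇ 0) ≡ 1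
∑-distance≡ᵇ0 {w} {ℓ} p = begin
  ∑[ q ∈ points w ℓ ] 𝟙 (distance p q ≡ᵇ 0)  ≡⟨ ∑-cong (points w ℓ) (λ q → cong 𝟙 (=ᵖ≡distance≡ᵇ0 p q)) ⟨
  ∑[ q ∈ points w ℓ ] 𝟙 (p =ᵖ q)             ≡⟨ ∑-cong (points w ℓ) (λ q → *-identityʳ _) ⟨
  ∑[ q ∈ points w ℓ ] (𝟙 (p =ᵖ q) * 1)       ≡⟨ ∑-δ p (λ _ → 1) ⟩
  1                                          ∎
  where open ≡-Reasoning

farPairs-count : (w : ℕ) (ℓ : Fin w → ℕ) →
  farPairs w ℓ + length (points w ℓ) + length (points w ℓ) * ∑ℓ w ℓ ≡ length (points w ℓ) * length (points w ℓ)
farPairs-count w ℓ = begin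
  farPairs w ℓ + N + N * ∑ℓ w ℓ
    ≡⟨ cong₂ (λ x y → farPairs w ℓ + x + y) (sym (trans (∑-cong P ∑-distance≡ᵇ0) (∑-one P)))
                                             (sym (trans (∑-cong P neighbours) (∑-const P (∑ℓ w ℓ)))) ⟩
  farPairs w ℓ + ∑∑ (λ p q → 𝟙 (distance p q ≡ᵇ 0)) + ∑∑ (λ p q → 𝟙 (distance p q ≡ᵇ 1))
    ≡⟨ rotate (farPairs w ℓ) _ _ ⟩
  ∑∑ (λ p q → 𝟙 (distance p q ≡ᵇ 0)) + ∑∑ (λ p q → 𝟙 (distance p q ≡ᵇ 1)) + farPairs w ℓ
    ≡⟨ trans (∑∑-+ (λ p q → 𝟙 (distance p q ≡ᵇ 0) + 𝟙 (distance p q ≡ᵇ 1)) (λ p q → 𝟙 (1 <ᵇ distance p q)))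
             (cong (_+ farPairs w ℓ) (∑∑-+ (λ p q → 𝟙 (distance p q ≡ᵇ 0)) (λ p q → 𝟙 (distance p q ≡ᵇ 1)))) ⟨
  ∑∑ (λ p q → 𝟙 (distance p q ≡ᵇ 0) + 𝟙 (distance p q ≡ᵇ 1) + 𝟙 (1 <ᵇ distance p q))
    ≡⟨ ∑-cong P (λ p → ∑-cong P (λ q → distance-trichotomy (distance p q))) ⟩
  ∑∑ (λ p q → 1)
    ≡⟨ trans (∑-cong P (λ p → ∑-one P)) (∑-const P N) ⟩
  N * N ∎
  where
  open ≡-Reasoning
  P = points w ℓ
  N = length P
  ∑∑ : (Point w ℓ → Point w ℓ → ℕ) → ℕ
  ∑∑ f = ∑[ p ∈ P ] ∑[ q ∈ P ] f p q
  ∑∑-+ : (f g : Point w ℓ → Point w ℓ → ℕ) → ∑∑ (λ p q → f p q + g p q) ≡ ∑∑ f + ∑∑ g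
  ∑∑-+ f g = trans (∑-cong P (λ p → ∑-+ P (f p) (g p))) (∑-+ P _ _)
  rotate : ∀ a b c → a + b + c ≡ b + c + a
  rotate = solve-∀

sum-map : (xs : List A) (f : A → ℕ) → sum (map f xs) ≡ ∑ xs f
sum-map []       f = refl
sum-map (x ∷ xs) f = cong (f x +_) (sum-map xs f)

product-map-allFin-suc : (f : Fin (suc n) → ℕ) → product (map f (allFin (suc n))) ≡ f zero * product (map (f ∘ suc) (allFin n))
product-map-allFin-suc {n} f = cong (λ xs → f zero * product xs) (trans (map-tabulate suc f) (sym (map-tabulate (λ i → i) (f ∘ suc))))

product-map-filter-≢ : (f : Fin n → ℕ) (k : Fin n) (xs : List (Fin n)) → Unique xs → k ∈ xs →
  product (map f xs) ≡ f k * product (map f (filter (λ i → ¬? (i Fin.≟ k)) xs))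
product-map-filter-≢ f k (x ∷ xs) (x∉xs ∷ unique) k∈ with x Fin.≟ k
... | yes refl = cong (λ ys → f x * product (map f ys)) (sym (filter-all (λ i → ¬? (i Fin.≟ x)) (All.map (λ x≢i i≡x → x≢i (sym i≡x)) x∉xs)))
... | no  x≢k with k∈
...   | here k≡x = ⊥-elim (x≢k (sym k≡x))
...   | there k∈xs = trans (cong (f x *_) (product-map-filter-≢ f k xs unique k∈xs)) (left-comm (f x) (f k) _)
  where
  left-comm : ∀ a b c → a * (b * c) ≡ b * (a * c)
  left-comm = solve-∀

prodAll≡length-points : (w : ℕ) (ℓ : Fin w → ℕ) → prodAll w ℓ ≡ length (points w ℓ)
prodAll≡length-points zero    ℓ = refl
prodAll≡length-points (suc w) ℓ = begin
  prodAll (suc w) ℓ                            ≡⟨ product-map-allFin-suc (suc ∘ ℓ) ⟩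
  suc (ℓ zero) * prodAll w (ℓ ∘ suc)           ≡⟨ cong (suc (ℓ zero) *_) (prodAll≡length-points w (ℓ ∘ suc)) ⟩
  suc (ℓ zero) * length (points w (ℓ ∘ suc))   ≡⟨ length-points-suc w ℓ ⟨
  length (points (suc w) ℓ)                    ∎
  where open ≡-Reasoning

sumTerm≡∑ℓ*prodAll : (w : ℕ) (ℓ : Fin w → ℕ) → sumTerm w ℓ ≡ ∑ℓ w ℓ * prodAll w ℓ
sumTerm≡∑ℓ*prodAll w ℓ = begin
  sumTerm w ℓ                                                ≡⟨ sum-map (allFin w) _ ⟩
  ∑[ k ∈ allFin w ] (suc (ℓ k) * ℓ k * prodExcept w ℓ k)     ≡⟨ ∑-cong (allFin w) term ⟩
  ∑[ k ∈ allFin w ] (ℓ k * prodAll w ℓ)                      ≡⟨ ∑-*ʳ (allFin w) (prodAll w ℓ) ℓ ⟩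
  ∑ℓ w ℓ * prodAll w ℓ                                       ∎
  where
  open ≡-Reasoning
  term : ∀ k → suc (ℓ k) * ℓ k * prodExcept w ℓ k ≡ ℓ k * prodAll w ℓ
  term k = begin
    suc (ℓ k) * ℓ k * prodExcept w ℓ k     ≡⟨ regroup (suc (ℓ k)) (ℓ k) (prodExcept w ℓ k) ⟩
    ℓ k * (suc (ℓ k) * prodExcept w ℓ k)   ≡⟨ cong (ℓ k *_) (product-map-filter-≢ (suc ∘ ℓ) k (allFin w) (allFin⁺ w) (∈-allFin k)) ⟨
    ℓ k * prodAll w ℓ                      ∎
    where
    regroup : ∀ a b c → a * b * c ≡ b * (a * c)
    regroup = solve-∀

disagree-bound : {L₁ L₂ : List (Downset w ℓ)} → IsLinearExtension L₁ → IsLinearExtension L₂ →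
  4 * disagree L₁ L₂ ≤ farPairs w ℓ
disagree-bound isLE₁ isLE₂ = subst (λ k → 4 * k ≤ _) (sym (disagree≡inversions isLE₁ isLE₂))
  (inversions-bound (rank-isRanking isLE₁) (rank-isRanking isLE₂))

lexColex-disagree : (w : ℕ) (ℓ : Fin w → ℕ) → 4 * disagree (lexExtension w ℓ) (colexExtension w ℓ) ≡ farPairs w ℓ
lexColex-disagree w ℓ = begin
  4 * disagree (lexExtension w ℓ) (colexExtension w ℓ)
    ≡⟨ cong (4 *_) (disagree≡inversions (lexExtension-isLinearExtension w ℓ) (colexExtension-isLinearExtension w ℓ)) ⟩
  4 * inversions (rank (lexExtension w ℓ)) (rank (colexExtension w ℓ))
    ≡⟨ cong (4 *_) (inversions-cong (rank-map (points w ℓ)) (rank-map (pointsʳ w ℓ))) ⟩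
  4 * inversions (lexRank w ℓ) (colexRank w ℓ)
    ≡⟨ lexColex-inversions w ℓ ⟩
  farPairs w ℓ ∎
  where open ≡-Reasoning

theorem7 : (w : ℕ) (ℓ : Fin w → ℕ) →
    ∃[ d ] (IsLinExtDiameter w ℓ d
    × 4 * d + sumTerm w ℓ + prodAll w ℓ ≡ prodAll w ℓ * prodAll w ℓ)
theorem7 w ℓ = d , (attained , bounded) , formula
  where
  d = disagree (lexExtension w ℓ) (colexExtension w ℓ)
  attained = lexExtension w ℓ , colexExtension w ℓ
           , lexExtension-isLinearExtension w ℓ , colexExtension-isLinearExtension w ℓ , refl
  bounded : ∀ L₁ L₂ → IsLinearExtension L₁ → IsLinearExtension L₂ → disagree L₁ L₂ ≤ d
  bounded L₁ L₂ isLE₁ isLE₂ =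
    *-cancelˡ-≤ 4 (subst (4 * disagree L₁ L₂ ≤_) (sym (lexColex-disagree w ℓ)) (disagree-bound isLE₁ isLE₂))
  formula : 4 * d + sumTerm w ℓ + prodAll w ℓ ≡ prodAll w ℓ * prodAll w ℓ
  formula rewrite sumTerm≡∑ℓ*prodAll w ℓ | prodAll≡length-points w ℓ | lexColex-disagree w ℓ =
    trans (swap (farPairs w ℓ) (∑ℓ w ℓ) (length (points w ℓ))) (farPairs-count w ℓ)
    where
    swap : ∀ f s n → f + s * n + n ≡ f + n + n * s
    swap = solve-∀
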